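{- Let $\sigma\le\tau$ in the consecutive pattern poset $S$, let $n=|\tau|-|\sigma|$, and let $C:\tau=\rho_0\to\rho_1\to\cdots\to\rho_n=\sigma$ be a maximal chain of $[\sigma,\tau]$ with chain id $l_1\ldots l_n$. For $0\le i<j\le n$, the interval $C(\rho_i,\rho_j)$ is a minimal skipped interval of $C$ (with respect to the lexicographic order of chain ids on the maximal chains of $[\sigma,\tau]$) if and only if either (a) $C(\rho_i,\rho_j)=\{\rho_{i+1}\}$ (i.e. $j=i+2$) and $\rho_{i+1}$ is a strong descent, or (b) $\rho_j=x(\rho_i)$, $x(\rho_i)\not\le i(\rho_i)$, and the sequence $l_{i+1},\ldots,l_j$ is decreasing (where a sequence consisting of a single label is not considered decreasing).
   Context: For $d\ge1$, $S_d$ is the set of permutations of $\{1,\dots,d\}$ in one-line notation, $S=\bigcup_{d>0}S_d$, and $|\tau|=d$ for $\tau\in S_d$. The standard form of a sequence of distinct integers $s(1)\ldots s(k)$ is the permutation in $S_k$ whose entries are in the same relative order. The consecutive pattern poset orders $S$ by $\sigma\le\tau$ ($\sigma\in S_k$, $\tau\in S_d$) iff for some $i$ the standard form of $\tau(i+1)\ldots\tau(i+k)$ equals $\sigma$. A permutation is monotone if its entries are strictly increasing or strictly decreasing. A prefix (resp. suffix) of length $k$ of $\rho\in S_d$ is the standard form of its first (resp. last) $k$ letters; it is proper if $k<d$. For $d>2$ the interior $i(\rho)$ is the standard form of $\rho(2)\ldots\rho(d-1)$. The exterior $x(\rho)$ is the longest permutation which is both a proper prefix and a suffix of $\rho$.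 In a maximal chain $\tau=\rho_0\to\cdots\to\rho_n=\sigma$ ($\to$ denotes a cover, $|\rho_i|=|\tau|-i$), the chain id $l_1\ldots l_n$ is defined inductively by windows of positions of $\tau$: $W_0=\{1,\dots,|\tau|\}$; given $W_{i-1}=\{a,\dots,b\}$ with the standard form of $\tau(a)\ldots\tau(b)$ equal to $\rho_{i-1}$: if $\rho_{i-1}$ is not monotone, exactly one of the standard forms of $\tau(a+1)\ldots\tau(b)$ and $\tau(a)\ldots\tau(b-1)$ equals $\rho_i$; in the first case put $l_i=a$, $W_i=\{a+1,\dots,b\}$, in the second $l_i=b$, $W_i=\{a,\dots,b-1\}$; if $\rho_{i-1}$ is monotone put $l_i=a$, $W_i=\{a+1,\dots,b\}$. Maximal chains of $[\sigma,\tau]$ are totally ordered by the lexicographic order of their chain ids. For $0\le i<j\le n$, $C(\rho_i,\rho_j)=\{\rho_{i+1},\dots,\rho_{j-1}\}$. A nonempty $C(\rho_i,\rho_j)$ is a skipped interval of $C$ if the set of elements of $C$ not in $C(\rho_i,\rho_j)$ is contained in some maximal chain $C'$ of $[\sigma,\tau]$ lexicographically earlier than $C$; it is a minimal skipped interval if it properly contains no other skipped interval of $C$. For $1\le k\le n-1$, $\rho_k$ is a strong descent if $l_k>l_{k+1}+1$. -}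

module Defs where

open import Data.Nat using (ℕ; zero; suc; _+_; _∸_; _<_; _≤_; _>_)
open import Data.Nat.Properties using (_<?_; _>?_; _≟_)
open import Data.List using (List; []; _∷_; length; map; filter; take; drop; upTo)
open import Data.List.Properties using (≡-dec)
open import Data.List.Relation.Unary.Linked using (Linked; linked?)
open import Data.List.Relation.Binary.Permutation.Propositional using (_↭_)
open import Data.List.Relation.Binary.Lex.Strict using (Lex-<)
open import Data.Product using (Σ; ∃; ∃-syntax; _×_; _,_; proj₁; proj₂)
open import Data.Sum using (_⊎_)
open import Data.Bool using (Bool; true; false; if_then_else_; _∨_)
open import Relation.Nullary using (¬_; does)
open import Relation.Binary.PropositionalEquality using (_≡_; _≢_)

-- Permutations are lists of naturals in one-line notation.
-- ρ ∈ S  iff  ρ is nonempty and a rearrangement of 1 … |ρ|.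
IsPerm : List ℕ → Set
IsPerm p = 1 ≤ length p × (p ↭ map suc (upTo (length p)))

std : List ℕ → List ℕ
std s = map (λ x → suc (length (filter (_<? x) s))) s

_≼_ : List ℕ → List ℕ → Set
σ ≼ τ = ∃[ i ] (i + length σ ≤ length τ × std (take (length σ) (drop i τ)) ≡ σ)

Cover : List ℕ → List ℕ → Set
Cover σ τ = σ ≼ τ × length τ ≡ suc (length σ)

Monotone : List ℕ → Set
Monotone p = Linked _<_ p ⊎ Linked _>_ p

monotone? : List ℕ → Bool
monotone? p = does (linked? _<?_ p) ∨ does (linked? _>?_ p)

-- A maximal chain τ = ρ 0 → ρ 1 → … → ρ n = σ of [σ, τ]
-- (values of ρ at indices > n are irrelevant).
record Chain (σ τ : List ℕ) (n : ℕ) : Set where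
  field
    ρ      : ℕ → List ℕ
    start  : ρ 0 ≡ τ
    end    : ρ n ≡ σ
    covers : ∀ k → k < n → Cover (ρ (suc k)) (ρ k)
open Chain public

-- Positions a … b (1-indexed) of τ.
slice : List ℕ → ℕ → ℕ → List ℕ
slice τ a b = take (suc b ∸ a) (drop (a ∸ 1) τ)

-- One step of the chain-id construction: current window (a , b), current
-- element cur = ρ_{i-1}, next element nxt = ρ_i; returns (l_i , W_i).
idStep : List ℕ → List ℕ → List ℕ → ℕ × ℕ → ℕ × (ℕ × ℕ)
idStep τ cur nxt (a , b) =
  if monotone? cur ∨ does (≡-dec _≟_ (std (slice τ (suc a) b)) nxt)
  then (a , (suc a , b))
  else (b , (a , b ∸ 1))

window : List ℕ → (ℕ → List ℕ) → ℕ → ℕ × ℕ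
window τ ρ zero    = (1 , length τ)
window τ ρ (suc i) = proj₂ (idStep τ (ρ i) (ρ (suc i)) (window τ ρ i))

-- Label l_{i+1} (labels l_1 … l_n; `label τ ρ (suc i)` is l_{i+1}).
label : List ℕ → (ℕ → List ℕ) → ℕ → ℕ
label τ ρ zero    = 0   -- unused (labels start at index 1)
label τ ρ (suc i) = proj₁ (idStep τ (ρ i) (ρ (suc i)) (window τ ρ i))

chainId : ∀ {σ τ n} → Chain σ τ n → List ℕ
chainId {τ = τ} {n = n} C = map (λ i → label τ (ρ C) (suc i)) (upTo n)

_<lex_ : ∀ {σ τ n} → Chain σ τ n → Chain σ τ n → Set
C' <lex C = Lex-< _≡_ _<_ (chainId C') (chainId C)

Skipped : ∀ {σ τ n} → Chain σ τ n → ℕ → ℕ → Set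
Skipped {σ} {τ} {n} C i j =
  suc (suc i) ≤ j × j ≤ n ×
  ∃[ C' ] (C' <lex C ×
    (∀ k → k ≤ n → (k ≤ i ⊎ j ≤ k) → ∃[ m ] (m ≤ n × ρ C' m ≡ ρ C k)))

-- C(ρ_i', ρ_j') ⊆ C(ρ_i, ρ_j) (chain elements are distinct, having distinct lengths,
-- so containment is containment of index ranges).
SubInt : ℕ → ℕ → ℕ → ℕ → Set
SubInt i' j' i j = ∀ k → i' < k → k < j' → (i < k × k < j)

MinSkipped : ∀ {σ τ n} → Chain σ τ n → ℕ → ℕ → Set
MinSkipped C i j =
  Skipped C i j ×
  (∀ i' j' → ¬ (Skipped C i' j' × SubInt i' j' i j × ¬ SubInt i j i' j'))

prefix : ℕ → List ℕ → List ℕ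
prefix k ρ = std (take k ρ)

suffix : ℕ → List ℕ → List ℕ
suffix k ρ = std (drop (length ρ ∸ k) ρ)

IsExterior : List ℕ → List ℕ → Set
IsExterior ρ π =
  ∃[ k ] (1 ≤ k × k < length ρ × π ≡ prefix k ρ × π ≡ suffix k ρ ×
          (∀ k' → k < k' → k' < length ρ → prefix k' ρ ≢ suffix k' ρ))

-- Interior i(ρ) = standard form of ρ(2) … ρ(d-1) (only used for d > 2).
interior : List ℕ → List ℕ
interior ρ = std (take (length ρ ∸ 2) (drop 1 ρ))

StrongDescent : ∀ {σ τ n} → Chain σ τ n → ℕ → Set
StrongDescent {τ = τ} {n = n} C k =
  1 ≤ k × k < n × suc (label τ (ρ C) (suc k)) < label τ (ρ C) k

Decreasing : ∀ {σ τ n} → Chain σ τ n → ℕ → ℕ → Set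
Decreasing {τ = τ} C i j =
  suc (suc i) ≤ j × (∀ k → i < k → k < j → label τ (ρ C) (suc k) < label τ (ρ C) k)

-- Along a maximal chain C : τ = ρ_0 → … → ρ_n = σ every ρ_k is the pattern of a block of
-- consecutive positions s+1 … s+|ρ_k| of τ, and this block is the window W_k of the chain-id
-- construction ("C is aligned at k with offset s").  Each step deletes the first letter of the
-- block (label s+1) or, only when that does not give ρ_{k+1}, the last one (label s+|ρ_k|).
-- Comparing chain ids at their first difference shows that C(ρ_i, ρ_j) is skipped iff C takes
-- a detour there: at some step q ∈ [i, j−2] it deletes the last letter although the block
-- without its first letter still contains ρ_j; conversely such a detour is turned into an
-- earlier chain by rerouting through that smaller block.  Hence minimal skipped intervals are
-- the detours with no detour on a proper sub-interval, and analysing those gives the theorem: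
-- either the detour has length two and ρ_{i+1} is a strong descent, or every step from i to j
-- deletes a last letter, so the labels decrease and ρ_j is the longest border x(ρ_i), which
-- is not a factor of the interior i(ρ_i).

module Submission where

open import Defs
open import Data.Nat using (ℕ; suc; _∸_; _<_; _≤_)
open import Data.List using (List; length)
open import Data.Product using (_×_)
open import Data.Sum using (_⊎_)
open import Relation.Nullary using (¬_)
open import Relation.Binary.PropositionalEquality using (_≡_)
open import Function.Bundles using (_⇔_)
open import Function.Bundles using (mk⇔)
open import Function.Construct.Composition using (_⇔-∘_)

open import Data.Nat using (zero; pred; _+_; _>_; z≤n; s≤s; _⊓_; _≤ᵇ_; _<ᵇ_)
open import Data.Nat.Properties
open import Data.List using ([]; _∷_; map; filter; take; drop; applyUpTo)
open import Data.List.Properties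
  using (≡-dec; filter-accept; filter-reject; filter-all; filter-none; length-map; map-∘; take-map; drop-map;
         length-take; length-drop; take-all; take-take; take-[]; drop-drop; map-cong-local; map-applyUpTo)
open import Data.List.Relation.Binary.Lex.Strict using (Lex-<)
open import Data.List.Relation.Binary.Lex.Core using (base; this; next)
open import Data.List.Membership.Propositional using (_∈_)
open import Data.List.Relation.Unary.Any using (here; there)
open import Data.List.Relation.Unary.All as All using (All; []; _∷_)
open import Data.List.Relation.Unary.AllPairs using (AllPairs; []; _∷_)
import Data.List.Relation.Unary.AllPairs.Properties as AllPairs
open import Data.List.Relation.Unary.Linked using (Linked; linked?)
import Data.List.Relation.Unary.Linked.Properties as Linked
open import Data.Product using (∃-syntax; _,_; proj₁; proj₂)
open import Data.Sum using (inj₁; inj₂; map₁)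
open import Data.Empty using (⊥; ⊥-elim)
open import Data.Bool using (Bool; true; false; _∨_; if_then_else_)
open import Relation.Nullary using (yes; no; does)
open import Relation.Nullary.Decidable using (dec-true; dec-false)
open import Data.Bool.Properties using (∨-zeroʳ; ¬-not)
open import Relation.Binary.PropositionalEquality
  using (_≢_; refl; sym; trans; cong; cong₂; subst; subst₂; module ≡-Reasoning)

smaller : ℕ → List ℕ → ℕ
smaller x u = length (filter (_<? x) u)

smaller-∷-< : ∀ {z x} u → z < x → smaller x (z ∷ u) ≡ suc (smaller x u)
smaller-∷-< u z<x = cong length (filter-accept (_<? _) z<x)

smaller-∷-≮ : ∀ {z x} u → ¬ z < x → smaller x (z ∷ u) ≡ smaller x u
smaller-∷-≮ u z≮x = cong length (filter-reject (_<? _) z≮x)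

smaller-mono : ∀ {x y} u → y ≤ x → smaller y u ≤ smaller x u
smaller-mono [] _ = z≤n
smaller-mono {x} {y} (z ∷ u) y≤x with z <? y | z <? x
... | yes p | yes q rewrite smaller-∷-< u p | smaller-∷-< u q = s≤s (smaller-mono u y≤x)
... | yes p | no q = ⊥-elim (q (<-≤-trans p y≤x))
... | no p | yes q rewrite smaller-∷-≮ u p | smaller-∷-< u q = m≤n⇒m≤1+n (smaller-mono u y≤x)
... | no p | no q rewrite smaller-∷-≮ u p | smaller-∷-≮ u q = smaller-mono u y≤x

smaller-strict : ∀ {x y} u → x ∈ u → x < y → suc (smaller x u) ≤ smaller y u
smaller-strict {x} {y} (z ∷ u) (here refl) x<y with z <? x | z <? y
... | yes p | _ = ⊥-elim (<-irrefl refl p)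
... | no p | yes q rewrite smaller-∷-≮ u p | smaller-∷-< u q = s≤s (smaller-mono u (<⇒≤ x<y))
... | no p | no q = ⊥-elim (q x<y)
smaller-strict {x} {y} (z ∷ u) (there x∈u) x<y with z <? x | z <? y
... | yes p | yes q rewrite smaller-∷-< u p | smaller-∷-< u q = s≤s (smaller-strict u x∈u x<y)
... | yes p | no q = ⊥-elim (q (<-trans p x<y))
... | no p | yes q rewrite smaller-∷-≮ u p | smaller-∷-< u q = m≤n⇒m≤1+n (smaller-strict u x∈u x<y)
... | no p | no q rewrite smaller-∷-≮ u p | smaller-∷-≮ u q = smaller-strict u x∈u x<y

OrderPreserving : (ℕ → ℕ) → List ℕ → Set
OrderPreserving f w = ∀ x y → x ∈ w → y ∈ w → (f x < f y → x < y) × (x < y → f x < f y)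

smaller-map : ∀ f {x w} → x ∈ w → OrderPreserving f w → ∀ v → (∀ y → y ∈ v → y ∈ w) →
              smaller (f x) (map f v) ≡ smaller x v
smaller-map f x∈w op [] v⊆w = refl
smaller-map f {x} x∈w op (y ∷ v) v⊆w with f y <? f x | y <? x
... | yes p | yes q rewrite filter-accept (_<? f x) {f y} {map f v} p | smaller-∷-< v q =
  cong suc (smaller-map f x∈w op v (λ z z∈ → v⊆w z (there z∈)))
... | yes p | no q = ⊥-elim (q (proj₁ (op y x (v⊆w y (here refl)) x∈w) p))
... | no p | yes q = ⊥-elim (p (proj₂ (op y x (v⊆w y (here refl)) x∈w) q))
... | no p | no q rewrite filter-reject (_<? f x) {f y} {map f v} p | smaller-∷-≮ v q =
  smaller-map f x∈w op v (λ z z∈ → v⊆w z (there z∈))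

std-map : ∀ f w → OrderPreserving f w → std (map f w) ≡ std w
std-map f w op = trans (sym (map-∘ w))
  (map-cong-local (All.tabulate (λ x∈ → cong suc (smaller-map f x∈ op w (λ y y∈ → y∈)))))

-- `std u` is the list of ranks `rank u x`, an order-preserving map on u.
rank : List ℕ → ℕ → ℕ
rank u x = suc (smaller x u)

rank-orderPreserving : ∀ u w → (∀ y → y ∈ w → y ∈ u) → OrderPreserving (rank u) w
rank-orderPreserving u w w⊆u x y x∈w y∈w = reflects , preserves
  where
  reflects : rank u x < rank u y → x < y
  reflects h with x <? y
  ... | yes p = p
  ... | no p = ⊥-elim (<-irrefl refl (<-≤-trans h (s≤s (smaller-mono u (≮⇒≥ p)))))
  preserves : x < y → rank u x < rank u y
  preserves h = s≤s (smaller-strict u (w⊆u x x∈w) h)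

factor : List ℕ → ℕ → ℕ → List ℕ
factor u s L = take L (drop s u)

∈-take : ∀ {A : Set} {x : A} n u → x ∈ take n u → x ∈ u
∈-take (suc n) (y ∷ u) (here p) = here p
∈-take (suc n) (y ∷ u) (there x∈) = there (∈-take n u x∈)

∈-drop : ∀ {A : Set} {x : A} n u → x ∈ drop n u → x ∈ u
∈-drop zero u x∈ = x∈
∈-drop (suc n) (y ∷ u) x∈ = there (∈-drop n u x∈)

std-factor-std : ∀ u s L → std (factor (std u) s L) ≡ std (factor u s L)
std-factor-std u s L = trans
  (cong std (trans (cong (take L) (drop-map s u)) (take-map L (drop s u))))
  (std-map (rank u) (factor u s L)
    (rank-orderPreserving u (factor u s L) (λ y y∈ → ∈-drop s u (∈-take L (drop s u) y∈))))

take-length : ∀ {A : Set} (u : List A) → take (length u) u ≡ u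
take-length u = take-all (length u) u ≤-refl

length-std : ∀ u → length (std u) ≡ length u
length-std u = length-map _ u

std-idem : ∀ u → std (std u) ≡ std u
std-idem u = begin
  std (std u)                               ≡⟨ cong std (sym (take-all (length u) (std u) (≤-reflexive (length-std u)))) ⟩
  std (factor (std u) 0 (length u))         ≡⟨ std-factor-std u 0 (length u) ⟩
  std (take (length u) u)                   ≡⟨ cong std (take-length u) ⟩
  std u                                     ∎
  where open ≡-Reasoning

std-factor-cong : ∀ u v → std u ≡ std v → ∀ s L → std (factor u s L) ≡ std (factor v s L)
std-factor-cong u v e s L = begin
  std (factor u s L)         ≡⟨ std-factor-std u s L ⟨
  std (factor (std u) s L)   ≡⟨ cong (λ z → std (factor z s L)) e ⟩
  std (factor (std v) s L)   ≡⟨ std-factor-std v s L ⟩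
  std (factor v s L)         ∎
  where open ≡-Reasoning

drop-take : ∀ {A : Set} s L (y : List A) → drop s (take L y) ≡ take (L ∸ s) (drop s y)
drop-take zero L y = refl
drop-take (suc s) zero y = refl
drop-take (suc s) (suc L) [] = sym (take-[] (L ∸ s))
drop-take (suc s) (suc L) (x ∷ y) = drop-take s L y

factor-factor : ∀ x s L s' L' → s' + L' ≤ L → factor (factor x s L) s' L' ≡ factor x (s + s') L'
factor-factor x s L s' L' h = begin
  take L' (drop s' (take L (drop s x)))          ≡⟨ cong (take L') (drop-take s' L (drop s x)) ⟩
  take L' (take (L ∸ s') (drop s' (drop s x)))   ≡⟨ take-take L' (L ∸ s') _ ⟩
  take (L' ⊓ (L ∸ s')) (drop s' (drop s x))      ≡⟨ cong₂ take (m≤n⇒m⊓n≡m L'≤) (drop-drop s s' x) ⟩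
  take L' (drop (s + s') x)                      ∎
  where
  open ≡-Reasoning
  L'≤ : L' ≤ L ∸ s'
  L'≤ = subst (_≤ L ∸ s') (m+n∸m≡n s' L') (∸-monoˡ-≤ s' h)

length-factor : ∀ u s L → s + L ≤ length u → length (factor u s L) ≡ L
length-factor u s L h = trans (length-take L (drop s u)) (trans (cong (L ⊓_) (length-drop s u))
  (m≤n⇒m⊓n≡m (subst (_≤ length u ∸ s) (m+n∸m≡n s L) (∸-monoˡ-≤ s h))))

ascending : ℕ → List ℕ
ascending zero = []
ascending (suc n) = 1 ∷ map suc (ascending n)

descending : ℕ → List ℕ
descending zero = []
descending (suc n) = suc n ∷ descending n

std-increasing : ∀ u → AllPairs _<_ u → std u ≡ ascending (length u)
std-increasing [] _ = refl
std-increasing (x ∷ u) (x<u ∷ inc) = cong₂ _∷_ head-rank (trans tail-ranks (cong (map suc) (std-increasing u inc)))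
  where
  head-rank : suc (smaller x (x ∷ u)) ≡ 1
  head-rank = cong suc (trans (smaller-∷-≮ u (<-irrefl refl))
    (cong length (filter-none (_<? x) (All.map (λ x<y y<x → <-asym x<y y<x) x<u))))
  tail-ranks : map (λ y → suc (smaller y (x ∷ u))) u ≡ map suc (std u)
  tail-ranks = trans (map-cong-local (All.map (λ x<y → cong suc (smaller-∷-< u x<y)) x<u)) (map-∘ u)

std-decreasing : ∀ u → AllPairs _>_ u → std u ≡ descending (length u)
std-decreasing [] _ = refl
std-decreasing (x ∷ u) (x>u ∷ dec) = cong₂ _∷_ head-rank (trans tail-ranks (std-decreasing u dec))
  where
  head-rank : suc (smaller x (x ∷ u)) ≡ suc (length u)
  head-rank = cong suc (trans (smaller-∷-≮ u (<-irrefl refl)) (cong length (filter-all (_<? x) x>u)))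
  tail-ranks : map (λ y → suc (smaller y (x ∷ u))) u ≡ std u
  tail-ranks = map-cong-local (All.map (λ x>y → cong suc (smaller-∷-≮ u (<-asym x>y))) x>u)

monotone?-sound : ∀ u → monotone? u ≡ true → Linked _<_ u ⊎ Linked _>_ u
monotone?-sound u h with linked? _<?_ u | linked? _>?_ u
... | yes inc | _ = inj₁ inc
... | no _ | yes dec = inj₂ dec

monotone-shift : ∀ u L → suc L ≤ length u → monotone? u ≡ true → std (factor u 1 L) ≡ std (factor u 0 L)
monotone-shift u L h mono with monotone?-sound u mono
... | inj₁ inc = begin
  std (factor u 1 L)   ≡⟨ std-increasing _ (AllPairs.take⁺ L (AllPairs.drop⁺ 1 pairs)) ⟩
  ascending (length (factor u 1 L))   ≡⟨ cong ascending (trans (length-factor u 1 L h) (sym (length-factor u 0 L (<⇒≤ h)))) ⟩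
  ascending (length (factor u 0 L))   ≡⟨ std-increasing _ (AllPairs.take⁺ L pairs) ⟨
  std (factor u 0 L)   ∎
  where
  open ≡-Reasoning
  pairs = Linked.Linked⇒AllPairs <-trans inc
... | inj₂ dec = begin
  std (factor u 1 L)   ≡⟨ std-decreasing _ (AllPairs.take⁺ L (AllPairs.drop⁺ 1 pairs)) ⟩
  descending (length (factor u 1 L))   ≡⟨ cong descending (trans (length-factor u 1 L h) (sym (length-factor u 0 L (<⇒≤ h)))) ⟩
  descending (length (factor u 0 L))   ≡⟨ std-decreasing _ (AllPairs.take⁺ L pairs) ⟨
  std (factor u 0 L)   ∎
  where
  open ≡-Reasoning
  pairs = Linked.Linked⇒AllPairs (λ a b → <-trans b a) dec

deletesFirst : List ℕ → List ℕ → List ℕ → ℕ → ℕ → Bool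
deletesFirst τ cur nxt a b = monotone? cur ∨ does (≡-dec _≟_ (std (slice τ (suc a) b)) nxt)

idStep-first : ∀ τ cur nxt a b → deletesFirst τ cur nxt a b ≡ true → idStep τ cur nxt (a , b) ≡ (a , (suc a , b))
idStep-first τ cur nxt a b h = cong (λ c → if c then (a , (suc a , b)) else (b , (a , b ∸ 1))) h

idStep-last : ∀ τ cur nxt a b → deletesFirst τ cur nxt a b ≡ false → idStep τ cur nxt (a , b) ≡ (b , (a , b ∸ 1))
idStep-last τ cur nxt a b h = cong (λ c → if c then (a , (suc a , b)) else (b , (a , b ∸ 1))) h

idStep-shape : ∀ τ x y a b → idStep τ x y (a , b) ≡ (a , (suc a , b)) ⊎ idStep τ x y (a , b) ≡ (b , (a , b ∸ 1))
idStep-shape τ x y a b = by-test (deletesFirst τ x y a b) refl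
  where
  by-test : ∀ c → deletesFirst τ x y a b ≡ c →
            idStep τ x y (a , b) ≡ (a , (suc a , b)) ⊎ idStep τ x y (a , b) ≡ (b , (a , b ∸ 1))
  by-test true eq = inj₁ (idStep-first τ x y a b eq)
  by-test false eq = inj₂ (idStep-last τ x y a b eq)

idStep-label-window : ∀ τ x y x' y' a b → a ≢ b → proj₁ (idStep τ x y (a , b)) ≡ proj₁ (idStep τ x' y' (a , b)) →
                      proj₂ (idStep τ x y (a , b)) ≡ proj₂ (idStep τ x' y' (a , b))
idStep-label-window τ x y x' y' a b a≢b e with idStep-shape τ x y a b | idStep-shape τ x' y' a b
... | inj₁ p | inj₁ q = trans (cong proj₂ p) (sym (cong proj₂ q))
... | inj₂ p | inj₂ q = trans (cong proj₂ p) (sym (cong proj₂ q))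
... | inj₁ p | inj₂ q = ⊥-elim (a≢b (trans (sym (cong proj₁ p)) (trans e (cong proj₁ q))))
... | inj₂ p | inj₁ q = ⊥-elim (a≢b (trans (sym (cong proj₁ q)) (trans (sym e) (cong proj₁ p))))

window-agree : ∀ τ (f g : ℕ → List ℕ) k → (∀ m → m ≤ k → f m ≡ g m) → window τ f k ≡ window τ g k
window-agree τ f g zero h = refl
window-agree τ f g (suc k) h = trans
  (cong₂ (λ x w → proj₂ (idStep τ x (f (suc k)) w)) (h k (n≤1+n k)) (window-agree τ f g k (λ m m≤ → h m (m≤n⇒m≤1+n m≤))))
  (cong (λ y → proj₂ (idStep τ (g k) y (window τ g k))) (h (suc k) ≤-refl))

label-agree : ∀ τ (f g : ℕ → List ℕ) k → (∀ m → m ≤ suc k → f m ≡ g m) → label τ f (suc k) ≡ label τ g (suc k)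
label-agree τ f g k h =
  trans (cong₂ (λ x w → proj₁ (idStep τ x (f (suc k)) w)) (h k (n≤1+n k)) (window-agree τ f g k (λ m m≤ → h m (m≤n⇒m≤1+n m≤))))
        (cong (λ y → proj₁ (idStep τ (g k) y (window τ g k))) (h (suc k) ≤-refl))

slice-factor : ∀ τ s L → slice τ (suc (suc s)) (s + suc L) ≡ factor τ (suc s) L
slice-factor τ s L = cong (λ z → take z (drop (suc s) τ)) (trans (cong (λ z → suc z ∸ suc (suc s)) (+-suc s L)) (m+n∸m≡n s L))

-- Along a maximal chain C the window W_k is always the block of positions s+1 … s+|ρ_k|
-- of τ for some offset s (C is "aligned" at k with offset s), and ρ_k is the pattern
-- of τ in that block.  Each step deletes the first or the last letter of the block.

module ChainWindows {σ τ : List ℕ} {n : ℕ} (C : Chain σ τ n) where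

  r : ℕ → List ℕ
  r = ρ C

  L : ℕ → ℕ
  L k = length (r k)

  W : ℕ → ℕ × ℕ
  W = window τ r

  lab : ℕ → ℕ
  lab = label τ r

  -- A cover removes one letter at an end: the first one (t = 1) or the last one (t = 0).
  cover-deletion : ∀ k → k < n → L k ≡ suc (L (suc k)) × ∃[ t ] (t ≤ 1 × r (suc k) ≡ std (factor (r k) t (L (suc k))))
  cover-deletion k k<n with covers C k k<n
  ... | (t , fits , occurs) , length≡ =
    length≡ , t , +-cancelʳ-≤ (L (suc k)) t 1 (subst (t + L (suc k) ≤_) length≡ fits) , sym occurs

  length-step : ∀ k → k < n → L k ≡ suc (L (suc k))
  length-step k k<n = proj₁ (cover-deletion k k<n)

  length-index : ∀ k → k ≤ n → L k + k ≡ length τ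
  length-index zero _ = trans (+-identityʳ _) (cong length (start C))
  length-index (suc k) k<n =
    trans (+-suc (L (suc k)) k) (trans (cong (_+ k) (sym (length-step k k<n))) (length-index k (<⇒≤ k<n)))

  Aligned : ℕ → ℕ → Set
  Aligned k s = W k ≡ (suc s , s + L k) × s + L k ≤ length τ × std (r k) ≡ std (factor τ s (L k))

  aligned-start : Aligned 0 0
  aligned-start = cong (λ z → (1 , length z)) (sym (start C)) , ≤-reflexive (cong length (start C)) ,
    subst (λ z → std z ≡ std (take (length z) τ)) (sym (start C)) (cong std (sym (take-length τ)))

  aligned-unique : ∀ {k s s'} → Aligned k s → Aligned k s' → s ≡ s'
  aligned-unique (w , _) (w' , _) = cong (λ z → pred (proj₁ z)) (trans (sym w) w')

  aligned-factor : ∀ {k s} → Aligned k s → ∀ t L' → t + L' ≤ L k → std (factor (r k) t L') ≡ std (factor τ (s + t) L')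
  aligned-factor {k} {s} (_ , _ , e) t L' h =
    trans (std-factor-cong (r k) (factor τ s (L k)) e t L') (cong std (factor-factor τ s (L k) t L' h))

  module _ {k s : ℕ} (k<n : k < n) (al : Aligned k s) where

    private
      Lk≡ : L k ≡ suc (L (suc k))
      Lk≡ = length-step k k<n

      first-factor : std (factor (r k) 1 (L (suc k))) ≡ std (factor τ (suc s) (L (suc k)))
      first-factor = trans (aligned-factor al 1 _ (≤-reflexive (sym Lk≡))) (cong (λ z → std (factor τ z (L (suc k)))) (+-comm s 1))

      last-factor : std (factor (r k) 0 (L (suc k))) ≡ std (factor τ s (L (suc k)))
      last-factor = trans (aligned-factor al 0 _ (subst (L (suc k) ≤_) (sym Lk≡) (n≤1+n _)))
                          (cong (λ z → std (factor τ z (L (suc k)))) (+-identityʳ s))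

    deleted-end : r (suc k) ≡ std (factor τ (suc s) (L (suc k))) ⊎ r (suc k) ≡ std (factor τ s (L (suc k)))
    deleted-end with cover-deletion k k<n
    ... | _ , t , t≤1 , rt with n≤1⇒n≡0∨n≡1 t≤1
    ...   | inj₁ refl = inj₂ (trans rt last-factor)
    ...   | inj₂ refl = inj₁ (trans rt first-factor)

    monotone-ends : monotone? (r k) ≡ true → std (factor τ s (L (suc k))) ≡ std (factor τ (suc s) (L (suc k)))
    monotone-ends mono =
      trans (sym last-factor) (trans (sym (monotone-shift (r k) _ (≤-reflexive (sym Lk≡)) mono)) first-factor)

    first-slice : std (slice τ (suc (suc s)) (s + L k)) ≡ std (factor τ (suc s) (L (suc k)))
    first-slice = cong std (trans (cong (λ z → slice τ (suc (suc s)) (s + z)) Lk≡) (slice-factor τ s _))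

  LeftStep : ℕ → ℕ → Set
  LeftStep k s = lab (suc k) ≡ suc s × W (suc k) ≡ (suc (suc s) , s + L k) × r (suc k) ≡ std (factor τ (suc s) (L (suc k)))

  RightStep : ℕ → ℕ → Set
  RightStep k s = lab (suc k) ≡ s + L k × W (suc k) ≡ (suc s , s + L (suc k)) × r (suc k) ≡ std (factor τ s (L (suc k)))
                  × r (suc k) ≢ std (factor τ (suc s) (L (suc k)))

  step : ∀ k s → k < n → Aligned k s → LeftStep k s ⊎ RightStep k s
  step k s k<n al with ≡-dec _≟_ (r (suc k)) (std (factor τ (suc s) (L (suc k))))
  ... | yes first = inj₁ (cong proj₁ idStep≡ , cong proj₂ idStep≡ , first)
    where
    test : deletesFirst τ (r k) (r (suc k)) (suc s) (s + L k) ≡ true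
    test = trans (cong (monotone? (r k) ∨_) (dec-true (≡-dec _≟_ (std (slice τ (suc (suc s)) (s + L k))) (r (suc k))) (trans (first-slice k<n al) (sym first)))) (∨-zeroʳ _)
    idStep≡ = trans (cong (idStep τ (r k) (r (suc k))) (proj₁ al)) (idStep-first τ (r k) (r (suc k)) (suc s) (s + L k) test)
  ... | no notFirst = inj₂ (cong proj₁ idStep≡ , trans (cong proj₂ idStep≡) (cong (suc s ,_) shrink) , last , notFirst)
    where
    last : r (suc k) ≡ std (factor τ s (L (suc k)))
    last with deleted-end k<n al
    ... | inj₁ first = ⊥-elim (notFirst first)
    ... | inj₂ last = last
    test : deletesFirst τ (r k) (r (suc k)) (suc s) (s + L k) ≡ false
    test = cong₂ _∨_ (¬-not (λ mono → notFirst (trans last (monotone-ends k<n al mono))))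
                     (dec-false (≡-dec _≟_ (std (slice τ (suc (suc s)) (s + L k))) (r (suc k))) (λ e → notFirst (trans (sym e) (first-slice k<n al))))
    idStep≡ = trans (cong (idStep τ (r k) (r (suc k))) (proj₁ al)) (idStep-last τ (r k) (r (suc k)) (suc s) (s + L k) test)
    shrink : s + L k ∸ 1 ≡ s + L (suc k)
    shrink = trans (cong (λ z → s + z ∸ 1) (length-step k k<n)) (cong (_∸ 1) (+-suc s _))

  private
    first-deleted-end : ∀ {k} s → k < n → suc s + L (suc k) ≡ s + L k
    first-deleted-end {k} s k<n = sym (trans (cong (s +_) (length-step k k<n)) (+-suc s (L (suc k))))

  label-lower-bound : ∀ {k s} → k < n → Aligned k s → suc s ≤ lab (suc k)
  label-lower-bound {k} {s} k<n al with step k s k<n al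
  ... | inj₁ (l , _) = ≤-reflexive (sym l)
  ... | inj₂ (l , _) = subst (suc s ≤_) (sym (trans l (cong (s +_) (length-step k k<n))))
                         (subst (suc s ≤_) (sym (+-suc s _)) (s≤s (m≤m+n s _)))

  aligned-left : ∀ {k s} → k < n → Aligned k s → LeftStep k s → Aligned (suc k) (suc s)
  aligned-left {k} {s} k<n (_ , fits , _) (_ , w , e) =
    trans w (cong (suc (suc s) ,_) (sym end≡)) , subst (_≤ length τ) (sym end≡) fits , trans (cong std e) (std-idem _)
    where
    end≡ = first-deleted-end s k<n

  aligned-right : ∀ {k s} → k < n → Aligned k s → RightStep k s → Aligned (suc k) s
  aligned-right {k} {s} k<n (_ , fits , _) (_ , w , e , _) =
    w , ≤-trans (+-monoʳ-≤ s (subst (L (suc k) ≤_) (sym (length-step k k<n)) (n≤1+n _))) fits , trans (cong std e) (std-idem _)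

  aligned-exists : ∀ k → k ≤ n → ∃[ s ] Aligned k s
  aligned-exists zero _ = 0 , aligned-start
  aligned-exists (suc k) k<n with aligned-exists k (<⇒≤ k<n)
  ... | s , al with step k s k<n al
  ...   | inj₁ left = suc s , aligned-left k<n al left
  ...   | inj₂ right = s , aligned-right k<n al right

  -- Every element after τ is itself a standard form, so alignment pins it down exactly.
  aligned-exact : ∀ {k s} → 0 < k → k ≤ n → Aligned k s → r k ≡ std (factor τ s (L k))
  aligned-exact {suc k} _ k<n (_ , _ , e) with cover-deletion k k<n
  ... | _ , t , _ , rt = trans rt (trans (sym (std-idem _)) (trans (cong std (sym rt)) e))

  step-nest : ∀ {k s s'} → k < n → Aligned k s → Aligned (suc k) s' → s ≤ s' × s' + L (suc k) ≤ s + L k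
  step-nest {k} {s} k<n al al' with step k s k<n al
  ... | inj₁ left rewrite aligned-unique al' (aligned-left k<n al left) =
    n≤1+n s , ≤-reflexive (first-deleted-end s k<n)
  ... | inj₂ right rewrite aligned-unique al' (aligned-right k<n al right) =
    ≤-refl , +-monoʳ-≤ s (subst (L (suc k) ≤_) (sym (length-step k k<n)) (n≤1+n _))

  nest : ∀ {k s s'} k' → k ≤ k' → k' ≤ n → Aligned k s → Aligned k' s' → s ≤ s' × s' + L k' ≤ s + L k
  nest k' k≤k' k'≤n al al' with m≤n⇒m<n∨m≡n k≤k'
  nest k' k≤k' k'≤n al al' | inj₂ refl rewrite aligned-unique al al' = ≤-refl , ≤-refl
  nest (suc k') k≤k' k'<n al al' | inj₁ k<k' with aligned-exists k' (<⇒≤ k'<n)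
  ... | s'' , al'' with nest k' (≤-pred k<k') (<⇒≤ k'<n) al al'' | step-nest k'<n al'' al'
  ...   | s≤s'' , end'' | s''≤s' , end' = ≤-trans s≤s'' s''≤s' , ≤-trans end' end''

  length-shift : ∀ k e → k + e ≤ n → L k ≡ L (k + e) + e
  length-shift k e h = +-cancelʳ-≡ k _ _ (begin
    L k + k                ≡⟨ length-index k (m+n≤o⇒m≤o k h) ⟩
    length τ               ≡⟨ length-index (k + e) h ⟨
    L (k + e) + (k + e)    ≡⟨ cong (L (k + e) +_) (+-comm k e) ⟩
    L (k + e) + (e + k)    ≡⟨ +-assoc (L (k + e)) e k ⟨
    L (k + e) + e + k      ∎)
    where open ≡-Reasoning

  length-antitone : ∀ k k' → k ≤ k' → k' ≤ n → L k' ≤ L k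
  length-antitone k k' k≤k' k'≤n =
    subst₂ _≤_ (cong L (m+[n∸m]≡n k≤k')) (sym (length-shift k (k' ∸ k) (subst (_≤ n) (sym (m+[n∸m]≡n k≤k')) k'≤n))) (m≤m+n _ _)

  length≥1 : 1 ≤ length σ → ∀ k → k ≤ n → 1 ≤ L k
  length≥1 σ≢[] k k≤n = ≤-trans (subst (λ z → 1 ≤ length z) (sym (end C)) σ≢[]) (length-antitone k n k≤n ≤-refl)

  length≥2 : 1 ≤ length σ → ∀ k → k < n → 2 ≤ L k
  length≥2 σ≢[] k k<n = subst (2 ≤_) (sym (length-step k k<n)) (s≤s (length≥1 σ≢[] (suc k) k<n))

lex-first-difference : ∀ n (f g : ℕ → ℕ) → Lex-< _≡_ _<_ (applyUpTo f n) (applyUpTo g n) →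
                       ∃[ q ] (q < n × (∀ k → k < q → f k ≡ g k) × f q < g q)
lex-first-difference zero f g (base ())
lex-first-difference (suc n) f g (this lt) = 0 , s≤s z≤n , (λ k ()) , lt
lex-first-difference (suc n) f g (next e rest) with lex-first-difference n (λ x → f (suc x)) (λ x → g (suc x)) rest
... | q , q<n , before , lt = suc q , s≤s q<n , before' , lt
  where
  before' : ∀ k → k < suc q → f k ≡ g k
  before' zero _ = e
  before' (suc k) (s≤s k<q) = before k k<q

lex-by-difference : ∀ n (f g : ℕ → ℕ) q → q < n → (∀ k → k < q → f k ≡ g k) → f q < g q →
                    Lex-< _≡_ _<_ (applyUpTo f n) (applyUpTo g n)
lex-by-difference (suc n) f g zero _ _ lt = this lt
lex-by-difference (suc n) f g (suc q) (s≤s q<n) before lt =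
  next (before 0 (s≤s z≤n)) (lex-by-difference n (λ x → f (suc x)) (λ x → g (suc x)) q q<n (λ k k<q → before (suc k) (s≤s k<q)) lt)

chainId-applyUpTo : ∀ {σ τ n} (C : Chain σ τ n) → chainId C ≡ applyUpTo (λ i → label τ (ρ C) (suc i)) n
chainId-applyUpTo {τ = τ} {n = n} C = map-applyUpTo (λ x → x) (λ i → label τ (ρ C) (suc i)) n

module Comparison {σ τ : List ℕ} {n : ℕ} (σ≢[] : 1 ≤ length σ) (C C' : Chain σ τ n) where
  open ChainWindows C
  module C' = ChainWindows C'

  same-length : ∀ k → k ≤ n → C'.L k ≡ L k
  same-length k h = +-cancelʳ-≡ k _ _ (trans (C'.length-index k h) (sym (length-index k h)))

  -- Chain elements have distinct lengths: an element of C' equal to ρ_k has index k.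
  same-element-index : ∀ k m → k ≤ n → m ≤ n → C'.r m ≡ r k → m ≡ k
  same-element-index k m k≤n m≤n e = +-cancelˡ-≡ (L k) _ _
    (trans (cong (_+ m) (sym (cong length e))) (trans (C'.length-index m m≤n) (sym (length-index k k≤n))))

  private
    ends-differ : ∀ k s → k < n → suc s ≢ s + L k
    ends-differ k s k<n e = 1+n≰n (subst (suc (suc s) ≤_) (sym e)
      (subst (_≤ s + L k) (+-comm s 2) (+-monoʳ-≤ s (length≥2 σ≢[] k k<n))))

  -- While the chain ids agree, so do the windows: a label determines the next window.
  windows-agree : ∀ q → q ≤ n → (∀ k → k < q → C'.lab (suc k) ≡ lab (suc k)) → ∀ k → k ≤ q → C'.W k ≡ W k
  windows-agree q q≤n same-before zero _ = refl
  windows-agree q q≤n same-before (suc k) k<q with aligned-exists k (<⇒≤ (<-≤-trans k<q q≤n))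
  ... | s , (W≡ , _) = begin
    proj₂ (idStep τ (C'.r k) (C'.r (suc k)) (C'.W k))   ≡⟨ cong (λ w → proj₂ (idStep τ (C'.r k) (C'.r (suc k)) w)) W'≡ ⟩
    proj₂ (idStep τ (C'.r k) (C'.r (suc k)) block)       ≡⟨ idStep-label-window τ (C'.r k) (C'.r (suc k)) (r k) (r (suc k))
                                                             (suc s) (s + L k) (ends-differ k s (<-≤-trans k<q q≤n)) labels≡ ⟩
    proj₂ (idStep τ (r k) (r (suc k)) block)             ≡⟨ cong (λ w → proj₂ (idStep τ (r k) (r (suc k)) w)) W≡ ⟨
    proj₂ (idStep τ (r k) (r (suc k)) (W k))             ∎
    where
    open ≡-Reasoning
    block : ℕ × ℕ
    block = (suc s , s + L k)
    W'≡ : C'.W k ≡ block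
    W'≡ = trans (windows-agree q q≤n same-before k (<⇒≤ k<q)) W≡
    labels≡ : proj₁ (idStep τ (C'.r k) (C'.r (suc k)) block) ≡ proj₁ (idStep τ (r k) (r (suc k)) block)
    labels≡ = trans (sym (cong (λ w → proj₁ (idStep τ (C'.r k) (C'.r (suc k)) w)) W'≡))
                    (trans (same-before k k<q) (cong (λ w → proj₁ (idStep τ (r k) (r (suc k)) w)) W≡))

  -- The offset is read off the window, so equal windows give equal alignments.
  aligned-transfer : ∀ {k s} → k ≤ n → C'.W k ≡ W k → Aligned k s → C'.Aligned k s
  aligned-transfer {k} k≤n W≡ al with C'.aligned-exists k k≤n
  ... | s' , al'@(W'≡ , _) = subst (C'.Aligned k) (cong (λ z → pred (proj₁ z)) (trans (sym W'≡) (trans W≡ (proj₁ al)))) al'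

  opposite-steps : ∀ {q s} → q < n → Aligned q s → C'.Aligned q s → C'.lab (suc q) < lab (suc q) →
                   C'.LeftStep q s × RightStep q s
  opposite-steps {q} {s} q<n al al' smaller-at with step q s q<n al | C'.step q s q<n al'
  ... | inj₂ right | inj₁ left = left , right
  ... | inj₁ (l , _) | inj₁ (l' , _) = ⊥-elim (<-irrefl (trans l' (sym l)) smaller-at)
  ... | inj₂ (l , _) | inj₂ (l' , _) = ⊥-elim (<-irrefl (trans l' (trans (cong (s +_) (same-length q (<⇒≤ q<n))) (sym l))) smaller-at)
  ... | inj₁ (l , _) | inj₂ (l' , _) = ⊥-elim (<⇒≱ (subst₂ _<_ l' l smaller-at)
    (subst (suc s ≤_) (cong (s +_) (sym (same-length q (<⇒≤ q<n))))
      (subst (_≤ s + L q) (+-comm s 1) (+-monoʳ-≤ s (≤-trans (s≤s z≤n) (length≥2 σ≢[] q q<n))))))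

  first-difference : C' <lex C →
    ∃[ q ] (q < n × ∃[ s ] (Aligned q s × RightStep q s × C'.Aligned q s × C'.LeftStep q s))
  first-difference earlier
    with lex-first-difference n _ _ (subst₂ (Lex-< _≡_ _<_) (chainId-applyUpTo C') (chainId-applyUpTo C) earlier)
  ... | q , q<n , same-before , smaller-at with aligned-exists q (<⇒≤ q<n)
  ...   | s , al = q , q<n , s , al , proj₂ steps , al' , proj₁ steps
    where
    al' : C'.Aligned q s
    al' = aligned-transfer (<⇒≤ q<n) (windows-agree q (<⇒≤ q<n) same-before q ≤-refl) al
    steps = opposite-steps q<n al al' smaller-at

OccursIn : List ℕ → List ℕ → ℕ → ℕ → Set
OccursIn τ β s Lw = ∃[ t ] (s ≤ t × t + length β ≤ s + Lw × β ≡ std (factor τ t (length β)))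

occursIn-widen : ∀ {τ β s L₁ L₂} → L₁ ≤ L₂ → OccursIn τ β s L₁ → OccursIn τ β s L₂
occursIn-widen {s = s} h (t , from , to , e) = t , from , ≤-trans to (+-monoʳ-≤ s h) , e

sub-block-≼ : ∀ τ β s₀ L₀ s₁ L₁ → std β ≡ std (factor τ s₀ L₀) → s₀ + L₀ ≤ length τ → length β ≡ L₀ →
              s₀ ≤ s₁ → s₁ + L₁ ≤ s₀ + L₀ → std (factor τ s₁ L₁) ≼ β
sub-block-≼ τ β s₀ L₀ s₁ L₁ e fits |β| s₀≤s₁ inside = s₁ ∸ s₀ , fits-in-β , occurs
  where
  offset : s₀ + (s₁ ∸ s₀) ≡ s₁
  offset = m+[n∸m]≡n s₀≤s₁
  inside' : (s₁ ∸ s₀) + L₁ ≤ L₀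
  inside' = +-cancelˡ-≤ s₀ _ _ (subst (_≤ s₀ + L₀) (trans (cong (_+ L₁) (sym offset)) (+-assoc s₀ (s₁ ∸ s₀) L₁)) inside)
  length-block : length (std (factor τ s₁ L₁)) ≡ L₁
  length-block = trans (length-std (factor τ s₁ L₁)) (length-factor τ s₁ L₁ (≤-trans inside fits))
  fits-in-β : (s₁ ∸ s₀) + length (std (factor τ s₁ L₁)) ≤ length β
  fits-in-β = subst₂ _≤_ (cong ((s₁ ∸ s₀) +_) (sym length-block)) (sym |β|) inside'
  occurs : std (factor β (s₁ ∸ s₀) (length (std (factor τ s₁ L₁)))) ≡ std (factor τ s₁ L₁)
  occurs rewrite length-block = trans (std-factor-cong β (factor τ s₀ L₀) e (s₁ ∸ s₀) L₁)
    (cong std (trans (factor-factor τ s₀ L₀ (s₁ ∸ s₀) L₁ inside') (cong (λ z → factor τ z L₁) offset)))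

-- Deleting u letters from the block (s, L) of τ, the first min(u, δ) of them at the left end
-- and the others at the right end.  Successive terms are covers.

slide : List ℕ → ℕ → ℕ → ℕ → ℕ → List ℕ
slide τ s L δ u = std (factor τ (s + u ⊓ δ) (L ∸ u))

∸-peel : ∀ m n → n < m → m ∸ n ≡ suc (m ∸ suc n)
∸-peel (suc m) n n<m = +-∸-assoc 1 (≤-pred n<m)

slide-fits : ∀ (τ : List ℕ) s L δ u → s + L ≤ length τ → u ≤ L → (s + u ⊓ δ) + (L ∸ u) ≤ length τ
slide-fits τ s L δ u fits u≤L = ≤-trans (+-monoˡ-≤ (L ∸ u) (+-monoʳ-≤ s (m⊓n≤m u δ)))
  (≤-trans (≤-reflexive (trans (+-assoc s u (L ∸ u)) (cong (s +_) (m+[n∸m]≡n u≤L)))) fits)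

length-slide : ∀ (τ : List ℕ) s L δ u → s + L ≤ length τ → u ≤ L → length (slide τ s L δ u) ≡ L ∸ u
length-slide τ s L δ u fits u≤L =
  trans (length-std (factor τ (s + u ⊓ δ) (L ∸ u))) (length-factor τ (s + u ⊓ δ) (L ∸ u) (slide-fits τ s L δ u fits u≤L))

slide-cover : ∀ (τ : List ℕ) s L δ u → s + L ≤ length τ → u < L → Cover (slide τ s L δ (suc u)) (slide τ s L δ u)
slide-cover τ s L δ u fits u<L = sub , length≡
  where
  length≡ : length (slide τ s L δ u) ≡ suc (length (slide τ s L δ (suc u)))
  length≡ = trans (length-slide τ s L δ u fits (<⇒≤ u<L))
              (trans (∸-peel L u u<L) (cong suc (sym (length-slide τ s L δ (suc u) fits u<L))))
  start-mono : u ⊓ δ ≤ suc u ⊓ δ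
  start-mono = ⊓-monoˡ-≤ δ (n≤1+n u)
  start-step : suc u ⊓ δ ≤ suc (u ⊓ δ)
  start-step = ⊓-monoʳ-≤ (suc u) (n≤1+n δ)
  end-mono : (s + suc u ⊓ δ) + (L ∸ suc u) ≤ (s + u ⊓ δ) + (L ∸ u)
  end-mono = begin
    (s + suc u ⊓ δ) + (L ∸ suc u)     ≤⟨ +-monoˡ-≤ (L ∸ suc u) (+-monoʳ-≤ s start-step) ⟩
    (s + suc (u ⊓ δ)) + (L ∸ suc u)   ≡⟨ cong (_+ (L ∸ suc u)) (+-suc s (u ⊓ δ)) ⟩
    suc (s + u ⊓ δ) + (L ∸ suc u)     ≡⟨ +-suc (s + u ⊓ δ) (L ∸ suc u) ⟨
    (s + u ⊓ δ) + suc (L ∸ suc u)     ≡⟨ cong ((s + u ⊓ δ) +_) (∸-peel L u u<L) ⟨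
    (s + u ⊓ δ) + (L ∸ u)             ∎
    where open ≤-Reasoning
  sub = sub-block-≼ τ (slide τ s L δ u) (s + u ⊓ δ) (L ∸ u) (s + suc u ⊓ δ) (L ∸ suc u)
          (std-idem (factor τ (s + u ⊓ δ) (L ∸ u))) (slide-fits τ s L δ u fits (<⇒≤ u<L))
          (length-slide τ s L δ u fits (<⇒≤ u<L)) (+-monoʳ-≤ s start-mono) end-mono

splice : (ℕ → List ℕ) → (ℕ → List ℕ) → ℕ → ℕ → ℕ → List ℕ
splice r f q j k = if k ≤ᵇ q then r k else (if k <ᵇ j then f (k ∸ suc q) else r k)

splice-before : ∀ r f {q j k} → k ≤ q → splice r f q j k ≡ r k
splice-before r f {q} {j} {k} k≤q with k ≤ᵇ q | ≤⇒≤ᵇ k≤q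
... | true | _ = refl

splice-between : ∀ r f {q j k} → q < k → k < j → splice r f q j k ≡ f (k ∸ suc q)
splice-between r f {q} {j} {k} q<k k<j with k ≤ᵇ q | ≤ᵇ⇒≤ k q | k <ᵇ j | <⇒<ᵇ k<j
... | true | k≤q | _ | _ = ⊥-elim (<⇒≱ q<k (k≤q _))
... | false | _ | true | _ = refl

splice-after : ∀ r f {q j k} → q < j → j ≤ k → splice r f q j k ≡ r k
splice-after r f {q} {j} {k} q<j j≤k with k ≤ᵇ q | ≤ᵇ⇒≤ k q | k <ᵇ j | <ᵇ⇒< k j
... | true | k≤q | _ | _ = ⊥-elim (<⇒≱ (<-≤-trans q<j j≤k) (k≤q _))
... | false | _ | true | k<j = ⊥-elim (<⇒≱ (k<j _) j≤k)
... | false | _ | false | _ = refl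

-- Skipped intervals are exactly the places where C takes a "detour": at some step q with
-- i ≤ q ≤ j−2, C deletes the last letter of its block although deleting the first letter
-- would differ from ρ_{q+1} yet still keep an occurrence of ρ_j inside the block.

module Detours {σ τ : List ℕ} {n : ℕ} (σ≢[] : 1 ≤ length σ) (C : Chain σ τ n) where
  open ChainWindows C

  Detour : ℕ → ℕ → Set
  Detour i j = ∃[ q ] (i ≤ q × suc q < j × ∃[ s ] (Aligned q s × r (suc q) ≢ std (factor τ (suc s) (L (suc q)))
                        × OccursIn τ (r j) (suc s) (L (suc q))))

  -- An earlier chain avoiding C(ρ_i, ρ_j) first deviates at a step q inside the interval,
  -- by deleting the first letter; from there on its blocks stay inside that block.
  skipped⇒detour : ∀ i j → Skipped C i j → Detour i j
  skipped⇒detour i j (_ , j≤n , C' , earlier , kept) with Comparison.first-difference σ≢[] C C' earlier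
  ... | q , q<n , s , al , right , al' , left = q , i≤q , q+1<j , s , al , notFirst , occurs
    where
    open Comparison σ≢[] C C'
    notFirst = proj₂ (proj₂ (proj₂ right))
    agree : ∀ k → k ≤ n → (k ≤ i ⊎ j ≤ k) → C'.r k ≡ r k
    agree k k≤n outside with kept k k≤n outside
    ... | m , m≤n , e = subst (λ z → C'.r z ≡ r k) (same-element-index k m k≤n m≤n e) e
    differs : C'.r (suc q) ≢ r (suc q)
    differs e = notFirst (trans (sym e) (trans (proj₂ (proj₂ left))
                  (cong (λ z → std (factor τ (suc s) z)) (same-length (suc q) q<n))))
    i≤q : i ≤ q
    i≤q with suc q ≤? i
    ... | yes h = ⊥-elim (differs (agree (suc q) q<n (inj₁ h)))
    ... | no h = ≤-pred (≰⇒> h)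
    q+1<j : suc q < j
    q+1<j with j ≤? suc q
    ... | yes h = ⊥-elim (differs (agree (suc q) q<n (inj₂ h)))
    ... | no h = ≰⇒> h
    occurs : OccursIn τ (r j) (suc s) (L (suc q))
    occurs with C'.aligned-exists j j≤n
    ... | sj , alj with C'.nest j (<⇒≤ q+1<j) j≤n (C'.aligned-left q<n al' left) alj
    ...   | from , to = sj , from ,
      subst₂ (λ x y → sj + x ≤ suc s + y) (same-length j j≤n) (same-length (suc q) q<n) to ,
      trans (sym (agree j j≤n (inj₂ ≤-refl)))
        (trans (C'.aligned-exact (<-trans (s≤s z≤n) q+1<j) j≤n alj) (cong (λ z → std (factor τ sj z)) (same-length j j≤n)))

  -- Conversely a detour yields an earlier chain avoiding C(ρ_i, ρ_j): follow C up to ρ_q,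
  -- delete the first letter, keep deleting first letters until the occurrence of ρ_j starts
  -- the block, then last letters until ρ_j is reached, and follow C again.
  module Reroute {i j q s t : ℕ} (j≤n : j ≤ n) (i≤q : i ≤ q) (q+1<j : suc q < j) (al : Aligned q s)
                 (notFirst : r (suc q) ≢ std (factor τ (suc s) (L (suc q))))
                 (from : suc s ≤ t) (to : t + L j ≤ suc s + L (suc q)) (rj : r j ≡ std (factor τ t (L j))) where

    q<n : q < n
    q<n = <-≤-trans (<-trans (n<1+n q) q+1<j) j≤n

    f : ℕ → List ℕ
    f = slide τ (suc s) (L (suc q)) (t ∸ suc s)

    ρ' : ℕ → List ℕ
    ρ' = splice r f q j

    before : ∀ {k} → k ≤ q → ρ' k ≡ r k
    before = splice-before r f {q} {j}

    between : ∀ {k} → q < k → k < j → ρ' k ≡ f (k ∸ suc q)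
    between = splice-between r f

    after : ∀ {k} → j ≤ k → ρ' k ≡ r k
    after = splice-after r f (<-trans (n<1+n q) q+1<j)

    block-fits : suc s + L (suc q) ≤ length τ
    block-fits = subst (_≤ length τ) (trans (cong (s +_) (length-step q q<n)) (+-suc s _)) (proj₁ (proj₂ al))

    slide-start : f 0 ≡ std (factor τ (suc s) (L (suc q)))
    slide-start = cong (λ z → std (factor τ z (L (suc q)))) (+-identityʳ (suc s))

    -- j − (q+1) deletions, of which t − (s+1) are at the left end, lead exactly to ρ_j.
    slide-end : f (j ∸ suc q) ≡ r j
    slide-end = trans (cong₂ (λ x y → std (factor τ x y)) start≡ length≡) (sym rj)
      where
      d = j ∸ suc q
      lengths : L j + d ≡ L (suc q)
      lengths = +-cancelʳ-≡ (suc q) _ _ (trans (+-assoc (L j) d (suc q))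
        (trans (cong (L j +_) (m∸n+n≡m (<⇒≤ q+1<j))) (trans (length-index j j≤n) (sym (length-index (suc q) q<n)))))
      length≡ : L (suc q) ∸ d ≡ L j
      length≡ = trans (cong (_∸ d) (sym lengths)) (m+n∸n≡m (L j) d)
      t≤ : t ≤ suc s + d
      t≤ = +-cancelʳ-≤ (L j) t (suc s + d)
        (subst (t + L j ≤_) (trans (cong (suc s +_) (trans (sym lengths) (+-comm (L j) d))) (sym (+-assoc (suc s) d (L j)))) to)
      start≡ : suc s + d ⊓ (t ∸ suc s) ≡ t
      start≡ = trans (cong (suc s +_) (m≥n⇒m⊓n≡n (subst (t ∸ suc s ≤_) (m+n∸m≡n (suc s) d) (∸-monoˡ-≤ (suc s) t≤))))
                     (m+[n∸m]≡n from)

    first-cover : Cover (f 0) (r q)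
    first-cover = subst (_≼ r q) (sym slide-start)
        (sub-block-≼ τ (r q) s (L q) (suc s) (L (suc q)) (proj₂ (proj₂ al)) (proj₁ (proj₂ al)) refl (n≤1+n s)
          (≤-reflexive (sym (trans (cong (s +_) (length-step q q<n)) (+-suc s _))))) ,
      trans (length-step q q<n) (cong suc (sym (length-slide τ (suc s) (L (suc q)) (t ∸ suc s) 0 block-fits z≤n)))

    slide-range : ∀ k → suc q ≤ k → k < j → k ∸ suc q < L (suc q)
    slide-range k q<k k<j = +-cancelʳ-≤ (suc q) (suc (k ∸ suc q)) (L (suc q))
      (subst (_≤ L (suc q) + suc q) (sym (cong suc (m∸n+n≡m q<k)))
        (≤-trans k<j (≤-trans (m≤n+m j (L j)) (≤-reflexive (trans (length-index j j≤n) (sym (length-index (suc q) q<n)))))))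

    covers' : ∀ k → k < n → Cover (ρ' (suc k)) (ρ' k)
    covers' k k<n with suc k ≤? q
    ... | yes k<q = subst₂ Cover (sym (before k<q)) (sym (before (<⇒≤ k<q))) (covers C k k<n)
    ... | no k≮q with k ≟ q
    ...   | yes refl = subst₂ Cover (sym (trans (between (n<1+n q) q+1<j) (cong f (n∸n≡0 q))))
                                    (sym (before ≤-refl)) first-cover
    ...   | no k≢q with j ≤? k
    ...     | yes j≤k = subst₂ Cover (sym (after (m≤n⇒m≤1+n j≤k))) (sym (after j≤k)) (covers C k k<n)
    ...     | no k≱j = subst₂ Cover (sym after-k) (sym (between q<k k<j)) slide-step
      where
      q<k : q < k
      q<k = ≤∧≢⇒< (≤-pred (≰⇒> k≮q)) (λ e → k≢q (sym e))
      k<j : k < j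
      k<j = ≰⇒> k≱j
      slide-step : Cover (f (suc k ∸ suc q)) (f (k ∸ suc q))
      slide-step = subst (λ z → Cover (f z) (f (k ∸ suc q))) (sym (+-∸-assoc 1 q<k))
        (slide-cover τ (suc s) (L (suc q)) (t ∸ suc s) (k ∸ suc q) block-fits (slide-range k q<k k<j))
      after-k : ρ' (suc k) ≡ f (suc k ∸ suc q)
      after-k with suc k <? j
      ... | yes k+1<j = between (<-trans q<k (n<1+n k)) k+1<j
      ... | no k+1≮j = trans (after (≮⇒≥ k+1≮j))
                          (trans (cong r k+1≡j) (trans (sym slide-end) (cong (λ z → f (z ∸ suc q)) (sym k+1≡j))))
        where
        k+1≡j : suc k ≡ j
        k+1≡j = ≤-antisym k<j (≮⇒≥ k+1≮j)

    chain : Chain σ τ n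
    chain = record { ρ = ρ' ; start = trans (before z≤n) (start C)
                   ; end = trans (after j≤n) (end C) ; covers = covers' }

    -- Both chains agree before step q; at step q the new chain deletes the first letter.
    earlier : chain <lex C
    earlier = subst₂ (Lex-< _≡_ _<_) (sym (chainId-applyUpTo chain)) (sym (chainId-applyUpTo C))
      (lex-by-difference n _ _ q q<n same-before label-smaller)
      where
      same-before : ∀ k → k < q → label τ ρ' (suc k) ≡ lab (suc k)
      same-before k k<q = label-agree τ ρ' r k (λ m m≤ → before (≤-trans m≤ k<q))
      window-q : window τ ρ' q ≡ (suc s , s + L q)
      window-q = trans (window-agree τ ρ' r q (λ m m≤q → before m≤q)) (proj₁ al)
      first : List ℕ
      first = std (factor τ (suc s) (L (suc q)))
      next-q : ρ' (suc q) ≡ first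
      next-q = trans (between (n<1+n q) q+1<j) (trans (cong f (n∸n≡0 q)) slide-start)
      test : deletesFirst τ (r q) first (suc s) (s + L q) ≡ true
      test = trans (cong (monotone? (r q) ∨_) (dec-true (≡-dec _≟_ (std (slice τ (suc (suc s)) (s + L q))) first)
               (first-slice q<n al))) (∨-zeroʳ _)
      label-first : label τ ρ' (suc q) ≡ suc s
      label-first = begin
        proj₁ (idStep τ (ρ' q) (ρ' (suc q)) (window τ ρ' q))  ≡⟨ cong₂ (λ x y → proj₁ (idStep τ x y (window τ ρ' q)))
                                                                   (before ≤-refl) next-q ⟩
        proj₁ (idStep τ (r q) first (window τ ρ' q))          ≡⟨ cong (λ w → proj₁ (idStep τ (r q) first w)) window-q ⟩
        proj₁ (idStep τ (r q) first (suc s , s + L q))        ≡⟨ cong proj₁ (idStep-first τ (r q) first (suc s) (s + L q) test) ⟩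
        suc s                                                 ∎
        where open ≡-Reasoning
      label-last : lab (suc q) ≡ s + L q
      label-last with step q s q<n al
      ... | inj₁ (_ , _ , first') = ⊥-elim (notFirst first')
      ... | inj₂ (l , _) = l
      label-smaller : label τ ρ' (suc q) < lab (suc q)
      label-smaller = subst₂ _<_ (sym label-first) (sym label-last)
        (subst (_≤ s + L q) (+-comm s 2) (+-monoʳ-≤ s (length≥2 σ≢[] q q<n)))

    kept : ∀ k → k ≤ n → (k ≤ i ⊎ j ≤ k) → ∃[ m ] (m ≤ n × ρ chain m ≡ r k)
    kept k k≤n (inj₁ k≤i) = k , k≤n , before (≤-trans k≤i i≤q)
    kept k k≤n (inj₂ j≤k) = k , k≤n , after j≤k

  detour⇒skipped : ∀ i j → suc (suc i) ≤ j → j ≤ n → Detour i j → Skipped C i j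
  detour⇒skipped i j i+2≤j j≤n (q , i≤q , q+1<j , s , al , notFirst , t , from , to , rj) =
    i+2≤j , j≤n , R.chain , R.earlier , R.kept
    where
    module R = Reroute j≤n i≤q q+1<j al notFirst from to rj

same-pattern-prefix : ∀ τ β a b Lb Lx → β ≡ std (factor τ a Lb) → β ≡ std (factor τ b Lb) → Lx ≤ Lb →
                      std (factor τ a Lx) ≡ std (factor τ b Lx)
same-pattern-prefix τ β a b Lb Lx ea eb Lx≤Lb = begin
  std (factor τ a Lx)                  ≡⟨ cong std (prefix-of a) ⟨
  std (factor (factor τ a Lb) 0 Lx)    ≡⟨ std-factor-cong (factor τ a Lb) (factor τ b Lb) same 0 Lx ⟩
  std (factor (factor τ b Lb) 0 Lx)    ≡⟨ cong std (prefix-of b) ⟩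
  std (factor τ b Lx)                  ∎
  where
  open ≡-Reasoning
  prefix-of : ∀ c → factor (factor τ c Lb) 0 Lx ≡ factor τ c Lx
  prefix-of c = trans (factor-factor τ c Lb 0 Lx Lx≤Lb) (cong (λ z → factor τ z Lx) (+-identityʳ c))
  same : std (factor τ a Lb) ≡ std (factor τ b Lb)
  same = trans (sym (std-idem _)) (trans (cong std (trans (sym ea) eb)) (std-idem _))

module Borders {σ τ : List ℕ} {n : ℕ} (C : Chain σ τ n) where
  open ChainWindows C

  aligned-prefix : ∀ {i s} → Aligned i s → ∀ k → k ≤ L i → prefix k (r i) ≡ std (factor τ s k)
  aligned-prefix {s = s} al k h = trans (aligned-factor al 0 k h) (cong (λ z → std (factor τ z k)) (+-identityʳ s))

  aligned-suffix : ∀ {i s} → Aligned i s → ∀ k → k ≤ L i → suffix k (r i) ≡ std (factor τ (s + (L i ∸ k)) k)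
  aligned-suffix {i} al k h = trans
    (cong std (sym (take-all k (drop (L i ∸ k) (r i)) (≤-reflexive (trans (length-drop (L i ∸ k) (r i)) (m∸[m∸n]≡n h))))))
    (aligned-factor al (L i ∸ k) k (≤-reflexive (m∸n+n≡m h)))

  private
    interior-fits : ∀ m → 2 ≤ m → 1 + (m ∸ 2) ≤ m
    interior-fits (suc (suc m)) _ = s≤s (n≤1+n m)
    interior-fits (suc zero) (s≤s ())

  length-interior : ∀ i → 2 ≤ L i → length (interior (r i)) ≡ L i ∸ 2
  length-interior i h = trans (length-std (factor (r i) 1 (L i ∸ 2))) (length-factor (r i) 1 (L i ∸ 2) (interior-fits (L i) h))

  aligned-interior : ∀ {i s} → Aligned i s → 2 ≤ L i → std (interior (r i)) ≡ std (factor τ (suc s) (L i ∸ 2))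
  aligned-interior {i} {s} al h = trans (std-idem (factor (r i) 1 (L i ∸ 2)))
    (trans (aligned-factor al 1 (L i ∸ 2) (interior-fits (L i) h)) (cong (λ z → std (factor τ z (L i ∸ 2))) (+-comm s 1)))

  occursIn⇒≼interior : ∀ {i s} → Aligned i s → 2 ≤ L i → ∀ β → OccursIn τ β (suc s) (L i ∸ 2) → β ≼ interior (r i)
  occursIn⇒≼interior {i} {s} al h β (t , from , to , e) = subst (_≼ interior (r i)) (sym e)
    (sub-block-≼ τ (interior (r i)) (suc s) (L i ∸ 2) t (length β) (aligned-interior al h) fits (length-interior i h) from to)
    where
    fits : suc s + (L i ∸ 2) ≤ length τ
    fits = ≤-trans (≤-trans (≤-reflexive (sym (+-suc s (L i ∸ 2)))) (+-monoʳ-≤ s (interior-fits (L i) h))) (proj₁ (proj₂ al))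

  ≼interior⇒occursIn : ∀ {i s} → Aligned i s → 2 ≤ L i → ∀ β → β ≼ interior (r i) → OccursIn τ β (suc s) (L i ∸ 2)
  ≼interior⇒occursIn {i} {s} al h β (x , fits , e) = suc s + x , m≤m+n (suc s) x ,
    subst (_≤ suc s + (L i ∸ 2)) (sym (+-assoc (suc s) x (length β))) (+-monoʳ-≤ (suc s) fits') ,
    trans (sym e) (trans (std-factor-cong (interior (r i)) (factor τ (suc s) (L i ∸ 2)) (aligned-interior al h) x (length β))
                         (cong std (factor-factor τ (suc s) (L i ∸ 2) x (length β) fits')))
    where
    fits' : x + length β ≤ L i ∸ 2
    fits' = subst (x + length β ≤_) (length-interior i h) fits

subInt-bounds : ∀ {i j i' j'} → SubInt i' j' i j → suc i' < j' → i ≤ i' × j' ≤ j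
subInt-bounds {j' = suc k} inner (s≤s i'<k) = ≤-pred (proj₁ (inner _ (n<1+n _) (s≤s i'<k))) , proj₂ (inner k i'<k (n<1+n k))

shrinks-properly : ∀ {i j i' j'} → i ≤ i' → j' ≤ j → ¬ SubInt i j i' j' → i < i' ⊎ j' < j
shrinks-properly {i} {j} {i'} {j'} i≤i' j'≤j not-outer with i <? i' | j' <? j
... | yes i<i' | _ = inj₁ i<i'
... | no _ | yes j'<j = inj₂ j'<j
... | no i≮i' | no j'≮j = ⊥-elim (not-outer (λ k i<k k<j → ≤-trans (s≤s (≮⇒≥ i≮i')) i<k , <-≤-trans k<j (≮⇒≥ j'≮j)))

outer-not-inside : ∀ i j i' j' → i ≤ i' → suc i' < j' → j' ≤ j → (i < i' ⊎ j' < j) → ¬ SubInt i j i' j'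
outer-not-inside i j i' j' i≤i' long j'≤j (inj₁ i<i') outer =
  <⇒≱ (proj₁ (outer (suc i) (n<1+n i) (≤-trans (s≤s (s≤s i≤i')) (≤-trans long j'≤j)))) i<i'
outer-not-inside i (suc k) i' j' i≤i' long j'≤j (inj₂ (s≤s j'≤k)) outer =
  <⇒≱ (proj₂ (outer k (≤-trans (s≤s i≤i') (≤-trans (<⇒≤ long) j'≤k)) (n<1+n k))) j'≤k

proper-subInt : ∀ {i j i' j'} → i ≤ i' → j' ≤ j → suc i' < j' → (i < i' ⊎ j' < j) → SubInt i' j' i j × ¬ SubInt i j i' j'
proper-subInt {i} {j} {i'} {j'} i≤i' j'≤j long shrinks =
  (λ k i'<k k<j' → <-≤-trans (s≤s i≤i') i'<k , <-≤-trans k<j' j'≤j) , outer-not-inside i j i' j' i≤i' long j'≤j shrinks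

module MinimalDetours {σ τ : List ℕ} {n : ℕ} (σ≢[] : 1 ≤ length σ) (C : Chain σ τ n) where
  open Detours σ≢[] C

  NoInnerDetour : ℕ → ℕ → Set
  NoInnerDetour i j = ∀ i' j' → i ≤ i' → j' ≤ j → suc (suc i') ≤ j' → (i < i' ⊎ j' < j) → ¬ Detour i' j'

  minSkipped⇔detour : ∀ {i j} → j ≤ n → MinSkipped C i j ⇔ (Detour i j × NoInnerDetour i j)
  minSkipped⇔detour {i} {j} j≤n = mk⇔ to from
    where
    to : MinSkipped C i j → Detour i j × NoInnerDetour i j
    to (skipped , minimal) = skipped⇒detour i j skipped , λ i' j' i≤i' j'≤j long shrinks detour →
      minimal i' j' (detour⇒skipped i' j' long (≤-trans j'≤j j≤n) detour , proper-subInt i≤i' j'≤j long shrinks)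
    from : Detour i j × NoInnerDetour i j → MinSkipped C i j
    from (detour@(q , i≤q , q+1<j , _) , none) =
      detour⇒skipped i j (≤-trans (s≤s (s≤s i≤q)) q+1<j) j≤n detour , λ where
        i' j' (skipped , inner , not-outer) → let (i≤i' , j'≤j) = subInt-bounds inner (proj₁ skipped) in
          none i' j' i≤i' j'≤j (proj₁ skipped) (shrinks-properly i≤i' j'≤j not-outer) (skipped⇒detour i' j' skipped)

module Characterisation {σ τ : List ℕ} {n : ℕ} (σ≢[] : 1 ≤ length σ) (C : Chain σ τ n) where
  open ChainWindows C
  open Borders C
  open Detours σ≢[] C
  open MinimalDetours σ≢[] C

  Characterised : ℕ → ℕ → Set
  Characterised i j = (j ≡ suc (suc i) × StrongDescent C (suc i))
                      ⊎ (IsExterior (r i) (r j) × ¬ (r j ≼ interior (r i)) × Decreasing C i j)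

  left-step-detour : ∀ {q k s} → q < k → k < n → Aligned q s → r (suc q) ≢ std (factor τ (suc s) (L (suc q))) →
                     LeftStep k s → Detour q (suc k)
  left-step-detour {q} {k} {s} q<k k<n al notFirst (_ , _ , rk) =
    q , ≤-refl , s≤s q<k , s , al , notFirst ,
    (suc s , ≤-refl , +-monoʳ-≤ (suc s) (length-antitone (suc q) (suc k) (s≤s (<⇒≤ q<k)) k<n) , rk)

  detour-at-start : ∀ {i j} → Detour i j → NoInnerDetour i j → ∃[ s ] (Aligned i s ×
                    r (suc i) ≢ std (factor τ (suc s) (L (suc i))) × OccursIn τ (r j) (suc s) (L (suc i)))
  detour-at-start {i} {j} (q , i≤q , q+1<j , s , al , notFirst , occurs) none with m≤n⇒m<n∨m≡n i≤q
  ... | inj₁ i<q = ⊥-elim (none q j (<⇒≤ i<q) ≤-refl q+1<j (inj₁ i<q) (q , ≤-refl , q+1<j , s , al , notFirst , occurs))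
  ... | inj₂ refl = s , al , notFirst , occurs

  module Forward {i jl s : ℕ} (al : Aligned i s) (long : suc (suc i) ≤ suc jl) (j≤n : suc jl ≤ n)
                 (notFirst : r (suc i) ≢ std (factor τ (suc s) (L (suc i))))
                 (occurs : OccursIn τ (r (suc jl)) (suc s) (L (suc i)))
                 (none : NoInnerDetour i (suc jl)) where

    private
      j : ℕ
      j = suc jl

    i<n : i < n
    i<n = <-trans (≤-pred long) j≤n

    first-right : RightStep i s
    first-right with step i s i<n al
    ... | inj₁ (_ , _ , first) = ⊥-elim (notFirst first)
    ... | inj₂ right = right

    -- Before the last step, C only deletes last letters: a first-letter deletion would be
    -- a shorter detour.
    right-steps : ∀ k → i ≤ k → suc k < j → Aligned k s × RightStep k s
    right-steps k i≤k k+1<j with m≤n⇒m<n∨m≡n i≤k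
    ... | inj₂ refl = al , first-right
    right-steps zero _ _ | inj₁ ()
    right-steps (suc k) _ k+2<j | inj₁ i<k+1 with right-steps k (≤-pred i<k+1) (<-trans (n<1+n _) k+2<j)
    ... | al-k , right-k = al' , right'
      where
      k+1<n : suc k < n
      k+1<n = <-trans (n<1+n _) (<-≤-trans k+2<j j≤n)
      al' : Aligned (suc k) s
      al' = aligned-right (<-trans (n<1+n k) k+1<n) al-k right-k
      right' : RightStep (suc k) s
      right' with step (suc k) s k+1<n al'
      ... | inj₂ right = right
      ... | inj₁ left = ⊥-elim (none i (suc (suc k)) ≤-refl (<⇒≤ k+2<j) (s≤s i<k+1) (inj₂ k+2<j)
                          (left-step-detour i<k+1 k+1<n al notFirst left))

    aligned-upto : ∀ k → i ≤ k → k < j → Aligned k s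
    aligned-upto k i≤k k<j with m≤n⇒m<n∨m≡n i≤k
    ... | inj₂ refl = al
    aligned-upto zero _ _ | inj₁ ()
    aligned-upto (suc k) _ k+1<j | inj₁ i<k+1 with right-steps k (≤-pred i<k+1) k+1<j
    ... | al-k , right-k = aligned-right (<-trans (n<1+n k) (<-≤-trans k+1<j j≤n)) al-k right-k

    private
      i+1<n : suc i < n
      i+1<n = ≤-trans long j≤n

      lengths-i : L i ≡ suc (suc (L (suc (suc i))))
      lengths-i = trans (length-step i i<n) (cong suc (length-step (suc i) i+1<n))

      end-i : suc s + L (suc i) ≡ s + L i
      end-i = sym (trans (cong (s +_) (length-step i i<n)) (+-suc s (L (suc i))))

      end-i+1 : suc s + L (suc (suc i)) ≡ s + L (suc i)
      end-i+1 = sym (trans (cong (s +_) (length-step (suc i) i+1<n)) (+-suc s (L (suc (suc i)))))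

    last-left : LeftStep jl s → Characterised i j
    last-left left with m≤n⇒m<n∨m≡n (≤-pred long)
    ... | inj₁ i+1<jl = ⊥-elim (none (suc i) j (n≤1+n i) ≤-refl (s≤s i+1<jl) (inj₁ (n<1+n i))
            (left-step-detour i+1<jl j≤n al-i+1 (proj₂ (proj₂ (proj₂ right-i+1))) left))
      where
      al-i+1 = proj₁ (right-steps (suc i) (n≤1+n i) (s≤s i+1<jl))
      right-i+1 = proj₂ (right-steps (suc i) (n≤1+n i) (s≤s i+1<jl))
    ... | inj₂ refl = inj₁ (refl , s≤s z≤n , i+1<n , strong)
      where
      strong : suc (lab (suc (suc i))) < lab (suc i)
      strong = subst₂ _<_ (cong suc (sym (proj₁ left))) (sym (proj₁ first-right))
        (subst (_≤ s + L i) (+-comm s 3) (+-monoʳ-≤ s (subst (3 ≤_) (sym lengths-i)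
          (s≤s (s≤s (length≥1 σ≢[] (suc (suc i)) i+1<n))))))

    module LastRight (last : RightStep jl s) where

      right-all : ∀ k → i ≤ k → k ≤ jl → RightStep k s
      right-all k i≤k k≤jl with m≤n⇒m<n∨m≡n k≤jl
      ... | inj₁ k<jl = proj₂ (right-steps k i≤k (s≤s k<jl))
      ... | inj₂ refl = last

      prefix-block : ∀ k → i < k → k ≤ j → r k ≡ std (factor τ s (L k))
      prefix-block (suc k) (s≤s i≤k) k+1≤j = proj₁ (proj₂ (proj₂ (right-all k i≤k (≤-pred k+1≤j))))

      no-inner-occurrence : ¬ OccursIn τ (r j) (suc s) (L (suc (suc i)))
      no-inner-occurrence occ@(t , from , to , e) with m≤n⇒m<n∨m≡n (≤-pred long)
      ... | inj₁ i+1<jl = none (suc i) j (n≤1+n i) ≤-refl (s≤s i+1<jl) (inj₁ (n<1+n i))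
              (suc i , ≤-refl , s≤s i+1<jl , s , proj₁ steps , proj₂ (proj₂ (proj₂ (proj₂ steps))) , occ)
        where
        steps = right-steps (suc i) (n≤1+n i) (s≤s i+1<jl)
      ... | inj₂ refl = proj₂ (proj₂ (proj₂ last)) (trans e (cong (λ z → std (factor τ z (L j))) t≡s+1))
        where
        t≡s+1 : t ≡ suc s
        t≡s+1 = ≤-antisym (+-cancelʳ-≤ (L j) t (suc s) to) from

      L-j≤L-i : L j ≤ L i
      L-j≤L-i = length-antitone i j (<⇒≤ (<-trans (n<1+n i) long)) j≤n

      suffix-block : r j ≡ std (factor τ (s + (L i ∸ L j)) (L j))
      suffix-block = subst (λ z → r j ≡ std (factor τ z (L j))) t≡ e
        where
        t = proj₁ occurs
        from = proj₁ (proj₂ occurs)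
        to = proj₁ (proj₂ (proj₂ occurs))
        e = proj₂ (proj₂ (proj₂ occurs))
        ends : (s + (L i ∸ L j)) + L j ≡ s + L i
        ends = trans (+-assoc s (L i ∸ L j) (L j)) (cong (s +_) (m∸n+n≡m L-j≤L-i))
        t≤ : t ≤ s + (L i ∸ L j)
        t≤ = +-cancelʳ-≤ (L j) t _ (subst (t + L j ≤_) (trans end-i (sym ends)) to)
        t≡ : t ≡ s + (L i ∸ L j)
        t≡ with m≤n⇒m<n∨m≡n t≤
        ... | inj₂ t≡ = t≡
        ... | inj₁ t< = ⊥-elim (no-inner-occurrence (t , from , subst (t + L j ≤_) (sym end-i+1) (≤-pred inside) , e))
          where
          inside : suc (t + L j) ≤ suc (s + L (suc i))
          inside = subst (suc (t + L j) ≤_) (trans ends (sym end-i)) (+-monoˡ-≤ (L j) t<)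

      -- A longer border of ρ_i would be the element ρ_{i+e} (e = |ρ_i| − its length), giving
      -- a first-letter deletion at step i (e = 1) or a shorter detour on (i, i+e) (e ≥ 2).
      no-longer-border : ∀ k' → L j < k' → k' < L i → prefix k' (r i) ≢ suffix k' (r i)
      no-longer-border k' L-j<k' k'<L-i border = by-gap (m≤n⇒m<n∨m≡n (m<n⇒0<n∸m k'<L-i))
        where
        _≤≡_ : ∀ {a b c} → a ≤ b → c ≡ a → c ≤ b
        a≤b ≤≡ c≡a = subst (_≤ _) (sym c≡a) a≤b
        e = L i ∸ k'
        k'+e : k' + e ≡ L i
        k'+e = m+[n∸m]≡n (<⇒≤ k'<L-i)
        i+e<j : i + e < j
        i+e<j = +-cancelˡ-≤ (L j) (suc (i + e)) j (begin
          L j + suc (i + e)   ≡⟨ +-suc (L j) (i + e) ⟩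
          suc (L j) + (i + e) ≤⟨ +-monoˡ-≤ (i + e) L-j<k' ⟩
          k' + (i + e)        ≡⟨ cong (k' +_) (+-comm i e) ⟩
          k' + (e + i)        ≡⟨ +-assoc k' e i ⟨
          k' + e + i          ≡⟨ cong (_+ i) k'+e ⟩
          L i + i             ≡⟨ trans (length-index i (<⇒≤ i<n)) (sym (length-index j j≤n)) ⟩
          L j + j             ∎)
          where open ≤-Reasoning
        L-at : L (i + e) ≡ k'
        L-at = +-cancelʳ-≡ e _ _ (trans (sym (length-shift i e (<⇒≤ (<-≤-trans i+e<j j≤n)))) (sym k'+e))
        r-at : r (i + e) ≡ std (factor τ (s + e) (L (i + e)))
        r-at = begin
          r (i + e)                          ≡⟨ prefix-block (i + e) (m<m+n i (m<n⇒0<n∸m k'<L-i)) (<⇒≤ i+e<j) ⟩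
          std (factor τ s (L (i + e)))       ≡⟨ cong (λ z → std (factor τ s z)) L-at ⟩
          std (factor τ s k')                ≡⟨ aligned-prefix al k' (<⇒≤ k'<L-i) ⟨
          prefix k' (r i)                    ≡⟨ border ⟩
          suffix k' (r i)                    ≡⟨ aligned-suffix al k' (<⇒≤ k'<L-i) ⟩
          std (factor τ (s + e) k')          ≡⟨ cong (λ z → std (factor τ (s + e) z)) L-at ⟨
          std (factor τ (s + e) (L (i + e))) ∎
          where open ≡-Reasoning
        fits : s + e + L (i + e) ≡ suc s + L (suc i)
        fits = trans (+-assoc s e _) (trans (cong (s +_) (trans (cong (e +_) L-at) (trans (+-comm e k') k'+e))) (sym end-i))
        by-gap : 1 < e ⊎ 1 ≡ e → ⊥
        by-gap (inj₂ 1≡e) = notFirst (subst₂ (λ a b → r a ≡ std (factor τ b (L a))) (+-comm i 1) (+-comm s 1)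
                              (subst (λ z → r (i + z) ≡ std (factor τ (s + z) (L (i + z)))) (sym 1≡e) r-at))
        by-gap (inj₁ 1<e) = none i (i + e) ≤-refl (<⇒≤ i+e<j) (+-monoʳ-≤ i 1<e ≤≡ +-comm 2 i) (inj₂ i+e<j)
                              (i , ≤-refl , +-monoʳ-≤ i 1<e ≤≡ +-comm 2 i , s , al , notFirst ,
                               (s + e , +-monoʳ-≤ s (<⇒≤ 1<e) ≤≡ +-comm 1 s , ≤-reflexive fits , r-at))

      exterior : IsExterior (r i) (r j)
      exterior = L j , length≥1 σ≢[] j j≤n , L-j<L-i ,
        trans (prefix-block j (<-trans (n<1+n i) long) ≤-refl) (sym (aligned-prefix al (L j) L-j≤L-i)) ,
        trans suffix-block (sym (aligned-suffix al (L j) L-j≤L-i)) ,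
        no-longer-border
        where
        L-j<L-i : L j < L i
        L-j<L-i = subst (L j <_) (sym (length-step i i<n)) (s≤s (length-antitone (suc i) j (<⇒≤ long) j≤n))

      not-in-interior : ¬ (r j ≼ interior (r i))
      not-in-interior inside = no-inner-occurrence (subst (OccursIn τ (r j) (suc s)) (cong (_∸ 2) lengths-i)
        (≼interior⇒occursIn al (subst (2 ≤_) (sym lengths-i) (s≤s (s≤s z≤n))) (r j) inside))

      -- Each label is the right end s + |ρ_k| of the current block, which shrinks.
      decreasing : Decreasing C i j
      decreasing = long , labels
        where
        labels : ∀ k → i < k → k < j → lab (suc k) < lab k
        labels (suc k) (s≤s i≤k) k+1<j = subst₂ _<_ (sym (proj₁ (right-all (suc k) (m≤n⇒m≤1+n i≤k) (≤-pred k+1<j))))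
          (sym (proj₁ (right-all k i≤k (≤-trans (n≤1+n k) (≤-pred k+1<j)))))
          (+-monoʳ-< s (≤-reflexive (sym (length-step k (<-trans (n<1+n k) (<-≤-trans k+1<j j≤n))))))

    characterised : Characterised i j
    characterised with step jl s j≤n (aligned-upto jl (≤-trans (n≤1+n i) (≤-pred long)) (n<1+n jl))
    ... | inj₁ left = last-left left
    ... | inj₂ last = inj₂ (LastRight.exterior last , LastRight.not-in-interior last , LastRight.decreasing last)

  strong-descent-detour : ∀ {i s} → Aligned i s → StrongDescent C (suc i) → Detour i (suc (suc i))
  strong-descent-detour {i} {s} al (_ , i+1<n , strong) = from-step-i (step i s i<n al)
    where
    i<n : i < n
    i<n = <-trans (n<1+n i) i+1<n
    -- Step i deletes the last letter: otherwise l_{i+2} ≥ s + 2 > l_{i+1}.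
    -- Step i+1 deletes the first letter: otherwise l_{i+1} = l_{i+2} + 1.
    from-step-i : LeftStep i s ⊎ RightStep i s → Detour i (suc (suc i))
    from-step-i (inj₁ left) = ⊥-elim (<⇒≱ strong (≤-trans (≤-reflexive (proj₁ left)) (≤-trans (n≤1+n (suc s))
      (≤-trans (label-lower-bound i+1<n (aligned-left i<n al left)) (n≤1+n _)))))
    from-step-i (inj₂ right) = from-step-i+1 (step (suc i) s i+1<n (aligned-right i<n al right))
      where
      from-step-i+1 : LeftStep (suc i) s ⊎ RightStep (suc i) s → Detour i (suc (suc i))
      from-step-i+1 (inj₁ left') = left-step-detour (n<1+n i) i+1<n al (proj₂ (proj₂ (proj₂ right))) left'
      from-step-i+1 (inj₂ right') = ⊥-elim (<-irrefl (sym labels) strong)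
        where
        labels : lab (suc i) ≡ suc (lab (suc (suc i)))
        labels = trans (proj₁ right) (trans (cong (s +_) (length-step i i<n)) (trans (+-suc s _) (cong suc (sym (proj₁ right')))))

  short-no-inner : ∀ {i} → NoInnerDetour i (suc (suc i))
  short-no-inner {i} i' j' i≤i' j'≤j long (inj₁ i<i') _ = <⇒≱ (s≤s (s≤s i<i')) (≤-trans long j'≤j)
  short-no-inner {i} i' j' i≤i' j'≤j long (inj₂ j'<j) _ = <⇒≱ j'<j (≤-trans (s≤s (s≤s i≤i')) long)

  module Border {i j s : ℕ} (al : Aligned i s) (j≤n : j ≤ n) (ext : IsExterior (r i) (r j))
                (outside : ¬ (r j ≼ interior (r i))) (long : suc (suc i) ≤ j)
                (labels : ∀ k → i < k → k < j → lab (suc k) < lab k) where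

    private
      i<n : i < n
      i<n = <-trans (n<1+n i) (<-≤-trans long j≤n)

      lengths-i : L i ≡ suc (suc (L (suc (suc i))))
      lengths-i = trans (length-step i i<n) (cong suc (length-step (suc i) (<-≤-trans long j≤n)))

      2≤L-i : 2 ≤ L i
      2≤L-i = subst (2 ≤_) (sym lengths-i) (s≤s (s≤s z≤n))

      L-inner : L (suc (suc i)) ≡ L i ∸ 2
      L-inner = sym (cong (_∸ 2) lengths-i)

    not-inside : ¬ OccursIn τ (r j) (suc s) (L i ∸ 2)
    not-inside occ = outside (occursIn⇒≼interior al 2≤L-i (r j) occ)

    -- Every step from i to j deletes a last letter: a first-letter deletion at step k would
    -- make l_{k+2} ≥ l_{k+1} (k + 1 < j), or put ρ_j into the interior of ρ_i (k + 1 = j).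
    right-at : ∀ k → i ≤ k → k < j → Aligned k s → RightStep k s
    right-at k i≤k k<j al-k with step k s (<-≤-trans k<j j≤n) al-k
    ... | inj₂ right = right
    ... | inj₁ left with m≤n⇒m<n∨m≡n k<j
    ...   | inj₁ k+1<j = ⊥-elim (<⇒≱ (labels (suc k) (s≤s i≤k) k+1<j) (≤-trans (≤-reflexive (proj₁ left))
              (≤-trans (n≤1+n (suc s)) (label-lower-bound (<-≤-trans k+1<j j≤n) (aligned-left (<-≤-trans k<j j≤n) al-k left)))))
    ...   | inj₂ k+1≡j = ⊥-elim (not-inside (subst (λ z → OccursIn τ (r z) (suc s) (L i ∸ 2)) k+1≡j
              (suc s , ≤-refl , +-monoʳ-≤ (suc s) L-k+1≤ , proj₂ (proj₂ left))))
      where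
      L-k+1≤ : L (suc k) ≤ L i ∸ 2
      L-k+1≤ = subst (L (suc k) ≤_) L-inner
        (length-antitone (suc (suc i)) (suc k) (subst (suc (suc i) ≤_) (sym k+1≡j) long) (<-≤-trans k<j j≤n))

    right-steps : ∀ k → i ≤ k → k < j → Aligned k s × RightStep k s
    right-steps k i≤k k<j with m≤n⇒m<n∨m≡n i≤k
    ... | inj₂ refl = al , right-at i ≤-refl k<j al
    right-steps zero _ _ | inj₁ ()
    right-steps (suc k) _ k+1<j | inj₁ i<k+1 with right-steps k (≤-pred i<k+1) (<-trans (n<1+n k) k+1<j)
    ... | al-k , right-k = al' , right-at (suc k) (<⇒≤ i<k+1) k+1<j al'
      where
      al' = aligned-right (<-trans (n<1+n k) (<-≤-trans k+1<j j≤n)) al-k right-k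

    prefix-block : ∀ k → i < k → k ≤ j → r k ≡ std (factor τ s (L k))
    prefix-block (suc k) (s≤s i≤k) k+1≤j = proj₁ (proj₂ (proj₂ (proj₂ (right-steps k i≤k k+1≤j))))

    -- ρ_j is a suffix of ρ_i, so it occurs at the right end of the block shrunk at step i.
    suffix-detour : ∀ k → k < L i → r j ≡ suffix k (r i) → Detour i j
    suffix-detour k k<L-i is-suffix =
      i , ≤-refl , long , s , al , proj₂ (proj₂ (proj₂ (proj₂ (right-steps i ≤-refl (<-trans (n<1+n i) long))))) ,
      (s + (L i ∸ k) , subst (_≤ s + (L i ∸ k)) (+-comm s 1) (+-monoʳ-≤ s (m<n⇒0<n∸m k<L-i)) ,
       ≤-reflexive ends , trans is-suffix (trans (aligned-suffix al k (<⇒≤ k<L-i)) (cong (λ z → std (factor τ (s + (L i ∸ k)) z)) (sym L-j≡k))))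
      where
      L-j≡k : L j ≡ k
      L-j≡k = trans (cong length is-suffix) (trans (length-std (drop (L i ∸ k) (r i)))
                (trans (length-drop (L i ∸ k) (r i)) (m∸[m∸n]≡n (<⇒≤ k<L-i))))
      ends : s + (L i ∸ k) + L j ≡ suc s + L (suc i)
      ends = trans (cong (s + (L i ∸ k) +_) L-j≡k) (trans (+-assoc s (L i ∸ k) k)
               (trans (cong (s +_) (m∸n+n≡m (<⇒≤ k<L-i))) (trans (cong (s +_) (length-step i i<n)) (+-suc s _))))

    detour : Detour i j
    detour = suffix-detour (proj₁ ext) (proj₁ (proj₂ (proj₂ ext))) (proj₁ (proj₂ (proj₂ (proj₂ (proj₂ ext)))))

    private
      L-i+1 : L (suc i) ≡ suc (L i ∸ 2)
      L-i+1 = trans (length-step (suc i) (<-≤-trans long j≤n)) (cong suc L-inner)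

    -- An occurrence of ρ_{j'} in the block shrunk at a step q' of a proper sub-interval would
    -- put ρ_j into the interior of ρ_i: ρ_j is a prefix of ρ_{j'} (j' < j), or the block
    -- shrunk at q' > i already lies in the interior (j' = j).
    inner-occurrence : ∀ q' j' t → i ≤ q' → suc q' < j' → j' ≤ j → (i < q' ⊎ j' < j) →
                       suc s ≤ t → t + L j' ≤ suc s + L (suc q') → r j' ≢ std (factor τ t (L j'))
    inner-occurrence q' j' t i≤q' q'+1<j' j'≤j shrinks from to e with j' <? j
    ... | yes j'<j = not-inside (t , from , ≤-pred bound , trans (prefix-block j i<j ≤-refl)
                       (same-pattern-prefix τ (r j') s t (L j') (L j) (prefix-block j' i<j' j'≤j) e (<⇒≤ L-j<L-j')))
      where
      i<j = <-trans (n<1+n i) long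
      i<j' = <-trans (s≤s i≤q') q'+1<j'
      L-j<L-j' : L j < L j'
      L-j<L-j' = subst (L j <_) (sym (length-step j' (<-≤-trans j'<j j≤n))) (s≤s (length-antitone (suc j') j j'<j j≤n))
      bound : suc (t + L j) ≤ suc (suc s + (L i ∸ 2))
      bound = begin
        suc (t + L j)            ≡⟨ +-suc t (L j) ⟨
        t + suc (L j)            ≤⟨ +-monoʳ-≤ t L-j<L-j' ⟩
        t + L j'                 ≤⟨ to ⟩
        suc s + L (suc q')       ≤⟨ +-monoʳ-≤ (suc s) (length-antitone (suc i) (suc q') (s≤s i≤q') (<⇒≤ (<-≤-trans q'+1<j' j'≤n))) ⟩
        suc s + L (suc i)        ≡⟨ cong (suc s +_) L-i+1 ⟩
        suc s + suc (L i ∸ 2)    ≡⟨ +-suc (suc s) _ ⟩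
        suc (suc s + (L i ∸ 2))  ∎
        where
        open ≤-Reasoning
        j'≤n = ≤-trans j'≤j j≤n
    ... | no j'≮j with shrinks
    ...   | inj₂ j'<j = j'≮j j'<j
    ...   | inj₁ i<q' = not-inside (subst (λ z → OccursIn τ (r z) (suc s) (L i ∸ 2)) j'≡j
              (occursIn-widen L-q'+1≤ (t , from , to , e)))
      where
      j'≡j = ≤-antisym j'≤j (≮⇒≥ j'≮j)
      L-q'+1≤ : L (suc q') ≤ L i ∸ 2
      L-q'+1≤ = subst (L (suc q') ≤_) L-inner
        (length-antitone (suc (suc i)) (suc q') (s≤s i<q') (<⇒≤ (<-≤-trans q'+1<j' (≤-trans j'≤j j≤n))))

    no-inner : NoInnerDetour i j
    no-inner i' j' i≤i' j'≤j _ shrinks (q' , i'≤q' , q'+1<j' , s' , al' , _ , t , from , to , e) =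
      inner-occurrence q' j' t i≤q' q'+1<j' j'≤j shrinks' (subst (λ z → suc z ≤ t) s'≡s from)
        (subst (λ z → t + L j' ≤ suc z + L (suc q')) s'≡s to) e
      where
      i≤q' = ≤-trans i≤i' i'≤q'
      s'≡s = aligned-unique al' (proj₁ (right-steps q' i≤q' (<-≤-trans (<-trans (n<1+n q') q'+1<j') j'≤j)))
      shrinks' : i < q' ⊎ j' < j
      shrinks' = map₁ (λ i<i' → <-≤-trans i<i' i'≤q') shrinks

  minimal-detour⇔characterised : ∀ {i j} → i < j → j ≤ n → (Detour i j × NoInnerDetour i j) ⇔ Characterised i j
  minimal-detour⇔characterised {i} {suc jl} i<j j≤n = mk⇔ to from
    where
    al = proj₂ (aligned-exists i (<⇒≤ (<-≤-trans i<j j≤n)))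
    to : Detour i (suc jl) × NoInnerDetour i (suc jl) → Characterised i (suc jl)
    to (detour@(q , i≤q , q+1<j , _) , none) with detour-at-start detour none
    ... | s , al-i , notFirst , occurs =
      Forward.characterised al-i (≤-trans (s≤s (s≤s i≤q)) q+1<j) j≤n notFirst occurs none
    from : Characterised i (suc jl) → Detour i (suc jl) × NoInnerDetour i (suc jl)
    from (inj₁ (refl , strong)) = strong-descent-detour al strong , short-no-inner
    from (inj₂ (ext , outside , long , labels)) = Border.detour al j≤n ext outside long labels ,
                                                 Border.no-inner al j≤n ext outside long labels

theorem2p6 : (σ τ : List ℕ) → IsPerm σ → IsPerm τ → σ ≼ τ →
    (n : ℕ) → n ≡ length τ ∸ length σ → (C : Chain σ τ n) →
    (i j : ℕ) → i < j → j ≤ n →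
    MinSkipped C i j ⇔
      ((j ≡ suc (suc i) × StrongDescent C (suc i))
       ⊎ (IsExterior (ρ C i) (ρ C j) × ¬ (ρ C j ≼ interior (ρ C i)) × Decreasing C i j))
theorem2p6 σ τ (σ≢[] , _) _ _ n _ C i j i<j j≤n =
  Characterisation.minimal-detour⇔characterised σ≢[] C i<j j≤n ⇔-∘ MinimalDetours.minSkipped⇔detour σ≢[] C j≤n
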